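{- Let $G$ be a regular $K_3$-saturated graph. Then $G[K_2]$ is a regular $F$-saturated graph for every graph $F$ that contains a subgraph isomorphic to $F_6$ and is isomorphic to a subgraph of $(K_3)'_2$. In particular, $\liminf_{n\to\infty}\frac{rsat(n,F)}{n^2}=0$ for every such $F$.
   Context: All graphs are finite and simple. $G[K_2]$ is obtained from $G$ by replacing each vertex by an edge ($K_2$) and, for each edge $uv$ of $G$, joining all vertices of the copy for $u$ to all vertices of the copy for $v$. $F_6$ (the 3-sun) is the graph on vertices $a,b,c,d,e,f$ with edges $ab,ac,bc,ad,bd,be,ce,af,cf$. $(K_3)'_2$ is the graph on vertices $a_1,a_2,b_1,b_2,c_1,c_2$ with edges $a_1a_2,b_1b_2,c_1c_2$, all four edges $a_ib_j$, all four edges $b_ic_j$, and the edge $a_1c_1$. A graph is $F$-saturated if it contains no copy of $F$ but adding any edge between non-adjacent vertices creates a copy of $F$. $rsat(n,F)$ is the smallest number of edges in a regular $n$-vertex $F$-saturated graph (the liminf is over $n$ for which it exists). -}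

module Defs where

open import Data.Bool using (Bool; true; false; _∧_; _∨_; not; if_then_else_)
open import Data.Bool.Properties using (∨-comm)
open import Data.Nat using (ℕ; zero; suc; _+_; _*_; _<_; _≤_)
open import Data.Fin using (Fin; zero; suc; remQuot; _<?_; _≟_)
open import Data.Fin.Patterns using (0F; 1F; 2F; 3F; 4F; 5F)
open import Data.Product using (Σ; ∃; ∃-syntax; _×_; _,_; proj₁; proj₂)
open import Function.Definitions using (Injective)
open import Relation.Binary.PropositionalEquality using (_≡_; _≢_; refl)
open import Relation.Nullary using (¬_)
open import Relation.Nullary.Decidable using (⌊_⌋)

Adj : ℕ → Set
Adj n = Fin n → Fin n → Bool

record Graph (n : ℕ) : Set where
  field
    adj    : Adj n
    sym    : ∀ u v → adj u v ≡ adj v u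
    irrefl : ∀ u → adj u u ≡ false
open Graph public

countTrue : ∀ {n} → (Fin n → Bool) → ℕ
countTrue {zero}  p = 0
countTrue {suc n} p = (if p zero then 1 else 0) + countTrue (λ i → p (suc i))

sumFin : ∀ {m} → (Fin m → ℕ) → ℕ
sumFin {zero}  f = 0
sumFin {suc m} f = f zero + sumFin (λ i → f (suc i))

degree : ∀ {n} → Adj n → Fin n → ℕ
degree A u = countTrue (A u)

edges : ∀ {n} → Adj n → ℕ
edges A = sumFin (λ u → countTrue (λ v → ⌊ u <? v ⌋ ∧ A u v))

Regular : ∀ {n} → Adj n → Set
Regular A = ∃[ d ] (∀ u → degree A u ≡ d)

_⊑_ : ∀ {k n} → Adj k → Adj n → Set
_⊑_ {k} {n} F A = Σ (Fin k → Fin n) λ f →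
  Injective _≡_ _≡_ f × (∀ u v → F u v ≡ true → A (f u) (f v) ≡ true)

addEdge : ∀ {n} → Adj n → Fin n → Fin n → Adj n
addEdge A x y u v =
  A u v ∨ ((⌊ u ≟ x ⌋ ∧ ⌊ v ≟ y ⌋) ∨ (⌊ u ≟ y ⌋ ∧ ⌊ v ≟ x ⌋))

Saturated : ∀ {k n} → Adj k → Adj n → Set
Saturated {k} {n} F A =
  ¬ (F ⊑ A) × (∀ x y → x ≢ y → A x y ≡ false → F ⊑ addEdge A x y)

-- G[K₂]: vertex set Fin (n * 2) ≅ Fin n × Fin 2 (via remQuot);
-- (u,i) ~ (v,j) iff (u = v and i ≠ j) or uv ∈ E(G).

blowK2 : ∀ {n} → Adj n → Adj (n * 2)
blowK2 {n} A x y with remQuot {n} 2 x | remQuot {n} 2 y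
... | (u , i) | (v , j) = (⌊ u ≟ v ⌋ ∧ not ⌊ i ≟ j ⌋) ∨ A u v

k3e : Fin 3 → Fin 3 → Bool
k3e zero (suc zero) = true
k3e zero (suc (suc zero)) = true
k3e (suc zero) (suc (suc zero)) = true
k3e _ _ = false

K3 : Graph 3
K3 = record { adj = λ u v → k3e u v ∨ k3e v u
            ; sym = λ u v → ∨-comm (k3e u v) (k3e v u)
            ; irrefl = ir }
  where
  ir : ∀ u → k3e u u ∨ k3e u u ≡ false
  ir zero = refl
  ir (suc zero) = refl
  ir (suc (suc zero)) = refl

-- F₆ (3-sun): a=0, b=1, c=2, d=3, e=4, f=5;
-- edges ab, ac, bc, ad, bd, be, ce, af, cf
f6e : Fin 6 → Fin 6 → Bool
f6e 0F 1F = true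
f6e 0F 2F = true
f6e 1F 2F = true
f6e 0F 3F = true
f6e 1F 3F = true
f6e 1F 4F = true
f6e 2F 4F = true
f6e 0F 5F = true
f6e 2F 5F = true
f6e _ _ = false

F6 : Graph 6
F6 = record { adj = λ u v → f6e u v ∨ f6e v u
            ; sym = λ u v → ∨-comm (f6e u v) (f6e v u)
            ; irrefl = ir }
  where
  ir : ∀ u → f6e u u ∨ f6e u u ≡ false
  ir 0F = refl
  ir 1F = refl
  ir 2F = refl
  ir 3F = refl
  ir 4F = refl
  ir 5F = refl

-- (K₃)'₂: a₁=0, a₂=1, b₁=2, b₂=3, c₁=4, c₂=5;
-- edges a₁a₂, b₁b₂, c₁c₂, all aᵢbⱼ, all bᵢcⱼ, and a₁c₁
k32e : Fin 6 → Fin 6 → Bool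
k32e 0F 1F = true
k32e 2F 3F = true
k32e 4F 5F = true
k32e 0F 2F = true
k32e 0F 3F = true
k32e 1F 2F = true
k32e 1F 3F = true
k32e 2F 4F = true
k32e 2F 5F = true
k32e 3F 4F = true
k32e 3F 5F = true
k32e 0F 4F = true
k32e _ _ = false

K3'2 : Graph 6
K3'2 = record { adj = λ u v → k32e u v ∨ k32e v u
              ; sym = λ u v → ∨-comm (k32e u v) (k32e v u)
              ; irrefl = ir }
  where
  ir : ∀ u → k32e u u ∨ k32e u u ≡ false
  ir 0F = refl
  ir 1F = refl
  ir 2F = refl
  ir 3F = refl
  ir 4F = refl
  ir 5F = refl

module Submission where

-- G[K₂] projects onto G with fibres of size two, and a triangle of G[K₂] with vertices in three
-- different fibres would project onto a triangle of G.  So when G is triangle-free, two vertices of every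
-- triangle of G[K₂] share a fibre, and chasing this through the triangles abd, bce, acf around the
-- central triangle abc of F₆ puts three vertices into one fibre: F₆ ⋢ G[K₂].  A missing edge (u,i)(v,j)
-- of G[K₂] has u ≠ v non-adjacent in G, hence (G being K₃-saturated) a common neighbour w, and the
-- blow-up of the path u w v plus the new edge contains (K₃)'₂.  Blowing up turns degree d into 2d + 1,
-- so it remains to find sparse regular K₃-saturated graphs: the Cayley graph of ℤ/m with connection set
-- S = {±1, ±3, …, ±a} ∪ {a + s j : 0 < j < t}, where a = 2r + 1, s = a + 2, t = r + 1 and m = 2a + s t.
-- S is symmetric and sum-free, and every other nonzero residue is a sum of two elements of S, so the
-- graph is triangle-free of diameter 2, while its degree |S| ≤ 3r + 4 is of order √m.

open import Data.Bool using (Bool; true; false; _∧_; _∨_; not; if_then_else_)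
import Data.Bool.Properties as Boolₚ
open import Data.Empty using (⊥)
open import Data.Fin using (Fin; zero; suc; toℕ; fromℕ<; combine; remQuot; _≟_; _↑ˡ_; _↑ʳ_)
  renaming (_<?_ to _<?ᶠ_)
open import Data.Fin.Patterns using (0F; 1F; 2F; 3F; 4F; 5F)
open import Data.Fin.Permutation using (Permutation; permutation; _⟨$⟩ʳ_)
open import Data.Fin.Properties
  using (all?; toℕ<n; toℕ-injective; toℕ-fromℕ<; remQuot-combine; combine-remQuot;
         combine-injectiveˡ; combine-injectiveʳ; combine-surjective)
open import Data.List using (_∷_; [])
open import Data.Nat using (ℕ; zero; suc; _+_; _*_; _∸_; _≤_; _<_; z≤n; s≤s; NonZero; >-nonZero; >-nonZero⁻¹)
open import Data.Nat.DivMod using (_%_; _/_; m%n<n; m≡m%n+[m/n]*n; [m+kn]%n≡m%n; m<n⇒m%n≡m; m<n*o⇒m/o<n)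
open import Data.Nat.Properties renaming (_≟_ to _≟ℕ_)
open import Data.Nat.Tactic.RingSolver using (solve; solve-∀)
open import Algebra.Properties.CommutativeMonoid.Sum +-0-commutativeMonoid
  using (sum; sum-cong-≗; ∑-distrib-+; ∑-permute)
open import Algebra.Properties.CommutativeSemigroup +-commutativeSemigroup
  using (x∙yz≈y∙xz; xy∙z≈xz∙y; xy∙z≈zx∙y; xy∙z≈yx∙z; xy∙z≈yz∙x; xy∙z≈zy∙x)
open import Data.Product using (Σ; ∃₂; ∃-syntax; _×_; _,_; proj₁; proj₂; uncurry)
open import Data.Sum using (_⊎_; inj₁; inj₂)
open import Defs hiding (sym; irrefl)
open import Function.Base using (_∘_)
open import Function.Definitions using (Injective)
open import Relation.Binary.Bundles using (Setoid)
open import Relation.Binary.PropositionalEquality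
import Relation.Binary.Reasoning.Setoid as ≈-Reasoning
open import Relation.Nullary using (¬_; Dec; yes; no; contradiction)
open import Relation.Nullary.Decidable using (⌊_⌋; True; toWitness; _×-dec_; _→-dec_)

⌊⌋-true : ∀ {P : Set} (d : Dec P) → P → ⌊ d ⌋ ≡ true
⌊⌋-true (yes _) _ = refl
⌊⌋-true (no ¬p) p = contradiction p ¬p

⌊⌋-false : ∀ {P : Set} (d : Dec P) → ¬ P → ⌊ d ⌋ ≡ false
⌊⌋-false (yes p) ¬p = contradiction p ¬p
⌊⌋-false (no _) _ = refl

⌊⌋-true⁻¹ : ∀ {P : Set} (d : Dec P) → ⌊ d ⌋ ≡ true → P
⌊⌋-true⁻¹ (yes p) _ = p

∨-true⁻¹ : ∀ a {b} → a ∨ b ≡ true → a ≡ true ⊎ b ≡ true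
∨-true⁻¹ true _ = inj₁ refl
∨-true⁻¹ false h = inj₂ h

∨-trueˡ : ∀ {a} b → a ≡ true → a ∨ b ≡ true
∨-trueˡ _ refl = refl

∨-trueʳ : ∀ a {b} → b ≡ true → a ∨ b ≡ true
∨-trueʳ a refl = Boolₚ.∨-zeroʳ a

∧-true⁻¹ : ∀ a {b} → a ∧ b ≡ true → a ≡ true × b ≡ true
∧-true⁻¹ true h = refl , h

⌊⌋-not⁻¹ : ∀ {P : Set} (d : Dec P) → not ⌊ d ⌋ ≡ true → ¬ P
⌊⌋-not⁻¹ (no ¬p) _ = ¬p

Bool-ext : ∀ {a b} → (a ≡ true → b ≡ true) → (b ≡ true → a ≡ true) → a ≡ b
Bool-ext {true} a⇒b _ = sym (a⇒b refl)
Bool-ext {false} {true} _ b⇒a = b⇒a refl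
Bool-ext {false} {false} _ _ = refl

≟-sym : ∀ {n} (x y : Fin n) → ⌊ x ≟ y ⌋ ≡ ⌊ y ≟ x ⌋
≟-sym x y with x ≟ y | y ≟ x
... | yes _   | yes _   = refl
... | no _    | no _    = refl
... | yes x≡y | no y≢x  = contradiction (sym x≡y) y≢x
... | no x≢y  | yes y≡x = contradiction (sym y≡x) x≢y

𝟙 : Bool → ℕ
𝟙 b = if b then 1 else 0

sumFin≡sum : ∀ {n} (f : Fin n → ℕ) → sumFin f ≡ sum f
sumFin≡sum {zero} f = refl
sumFin≡sum {suc n} f = cong (f zero +_) (sumFin≡sum (f ∘ suc))

countTrue≡sum : ∀ {n} (p : Fin n → Bool) → countTrue p ≡ sum (𝟙 ∘ p)
countTrue≡sum {zero} p = refl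
countTrue≡sum {suc n} p = cong (𝟙 (p zero) +_) (countTrue≡sum (p ∘ suc))

sum-mono-≤ : ∀ {n} {f g : Fin n → ℕ} → (∀ i → f i ≤ g i) → sum f ≤ sum g
sum-mono-≤ {zero} f≤g = z≤n
sum-mono-≤ {suc n} f≤g = +-mono-≤ (f≤g zero) (sum-mono-≤ (f≤g ∘ suc))

sum-const : ∀ n c → sum {n} (λ _ → c) ≡ n * c
sum-const zero c = refl
sum-const (suc n) c = cong (c +_) (sum-const n c)

sum-↑ : ∀ m n (f : Fin (m + n) → ℕ) → sum f ≡ sum (λ i → f (i ↑ˡ n)) + sum (λ i → f (m ↑ʳ i))
sum-↑ zero n f = refl
sum-↑ (suc m) n f = trans (cong (f zero +_) (sum-↑ m n (f ∘ suc))) (sym (+-assoc (f zero) _ _))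

sum-combine : ∀ n k (f : Fin (n * k) → ℕ) → sum f ≡ sum {n} (λ u → sum {k} (λ j → f (combine u j)))
sum-combine zero k f = refl
sum-combine (suc n) k f =
  trans (sum-↑ k (n * k) f) (cong (sum (λ j → f (j ↑ˡ (n * k))) +_) (sum-combine n k (λ i → f (k ↑ʳ i))))

sum-δ : ∀ {n} (u : Fin n) → sum (λ v → 𝟙 ⌊ u ≟ v ⌋) ≡ 1
sum-δ {suc n} zero = cong suc (begin
  sum {n} (λ v → 𝟙 ⌊ zero ≟ suc v ⌋) ≡⟨ sum-cong-≗ {n} (λ v → cong 𝟙 (⌊⌋-false (zero ≟ suc v) λ ())) ⟩
  sum {n} (λ _ → 0)                   ≡⟨ sum-const n 0 ⟩
  n * 0                               ≡⟨ *-zeroʳ n ⟩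
  0                                   ∎)
  where open ≡-Reasoning
sum-δ {suc n} (suc u) = trans (sum-cong-≗ (λ v → cong 𝟙 (≟-suc v))) (sum-δ u)
  where
  ≟-suc : ∀ v → ⌊ suc u ≟ suc v ⌋ ≡ ⌊ u ≟ v ⌋
  ≟-suc v with u ≟ v
  ... | yes _ = refl
  ... | no _  = refl

countTrue-false : ∀ {n} → countTrue {n} (λ _ → false) ≡ 0
countTrue-false {zero} = refl
countTrue-false {suc n} = countTrue-false {n}

countTrue-cong : ∀ {n} {p q : Fin n → Bool} → (∀ w → p w ≡ q w) → countTrue p ≡ countTrue q
countTrue-cong {zero} _ = refl
countTrue-cong {suc n} p≗q = cong₂ _+_ (cong 𝟙 (p≗q zero)) (countTrue-cong (p≗q ∘ suc))

countTrue-≤-∨ : ∀ {n} {p q q′ : Fin n → Bool} → (∀ w → p w ≡ true → q w ≡ true ⊎ q′ w ≡ true) →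
                countTrue p ≤ countTrue q + countTrue q′
countTrue-≤-∨ {n} {p} {q} {q′} p⇒q∨q′ = begin
  countTrue p                      ≡⟨ countTrue≡sum p ⟩
  sum (𝟙 ∘ p)                      ≤⟨ sum-mono-≤ (λ w → pointwise (p w) (q w) (q′ w) (p⇒q∨q′ w)) ⟩
  sum (λ w → 𝟙 (q w) + 𝟙 (q′ w))   ≡⟨ ∑-distrib-+ {n} (𝟙 ∘ q) (𝟙 ∘ q′) ⟩
  sum (𝟙 ∘ q) + sum (𝟙 ∘ q′)       ≡⟨ cong₂ _+_ (countTrue≡sum q) (countTrue≡sum q′) ⟨
  countTrue q + countTrue q′       ∎
  where
  open ≤-Reasoning
  pointwise : ∀ a b b′ → (a ≡ true → b ≡ true ⊎ b′ ≡ true) → 𝟙 a ≤ 𝟙 b + 𝟙 b′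
  pointwise false _ _ _ = z≤n
  pointwise true b b′ h with h refl
  ... | inj₁ refl = s≤s z≤n
  ... | inj₂ refl = m≤n+m 1 (𝟙 b)

countTrue-mono : ∀ {n} {p q : Fin n → Bool} → (∀ w → p w ≡ true → q w ≡ true) → countTrue p ≤ countTrue q
countTrue-mono {n} {p} {q} p⇒q = begin
  countTrue p                            ≤⟨ countTrue-≤-∨ {n} {p} {q} {λ _ → false} (λ w → inj₁ ∘ p⇒q w) ⟩
  countTrue q + countTrue {n} (λ _ → false) ≡⟨ cong (countTrue q +_) (countTrue-false {n}) ⟩
  countTrue q + 0                        ≡⟨ +-identityʳ _ ⟩
  countTrue q                            ∎
  where open ≤-Reasoning

edges≤ : ∀ {n} (A : Adj n) {d} → (∀ u → degree A u ≡ d) → edges A ≤ n * d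
edges≤ {n} A {d} deg≡d = begin
  edges A                                               ≡⟨ sumFin≡sum {n} forward-degree ⟩
  sum {n} forward-degree                                ≤⟨ sum-mono-≤ {n} forward-degree≤degree ⟩
  sum (degree A)                                        ≡⟨ sum-cong-≗ {n} deg≡d ⟩
  sum {n} (λ _ → d)                                     ≡⟨ sum-const n d ⟩
  n * d                                                 ∎
  where
  open ≤-Reasoning
  forward-degree : Fin n → ℕ
  forward-degree u = countTrue (λ v → ⌊ u <?ᶠ v ⌋ ∧ A u v)
  forward-degree≤degree : ∀ u → forward-degree u ≤ degree A u
  forward-degree≤degree u = countTrue-mono {n} (λ v → proj₂ ∘ ∧-true⁻¹ ⌊ u <?ᶠ v ⌋)

regular⇒q*edges<p*n² : ∀ {n} (A : Adj n) {d p q} → (∀ u → degree A u ≡ d) → 0 < p → q * d < n →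
                       q * edges A < p * (n * n)
regular⇒q*edges<p*n² {n} A {d} {p} {q} deg≡d 0<p qd<n = begin-strict
  q * edges A  ≤⟨ *-monoʳ-≤ q (edges≤ A deg≡d) ⟩
  q * (n * d)  ≡⟨ solve (q ∷ n ∷ d ∷ []) ⟩
  n * (q * d)  <⟨ *-monoʳ-< n {{>-nonZero (≤-<-trans z≤n qd<n)}} qd<n ⟩
  n * n        ≤⟨ m≤n*m (n * n) p {{>-nonZero 0<p}} ⟩
  p * (n * n)  ∎
  where open ≤-Reasoning

countTrue-≟ : ∀ {n} c → countTrue {n} (λ w → ⌊ toℕ w ≟ℕ c ⌋) ≤ 1
countTrue-≟ {zero} c = z≤n
countTrue-≟ {suc n} zero = ≤-reflexive (cong suc (countTrue-false {n}))
countTrue-≟ {suc n} (suc c) = begin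
  countTrue {n} (λ w → ⌊ suc (toℕ w) ≟ℕ suc c ⌋) ≡⟨ countTrue-cong {n} (≟-suc ∘ toℕ) ⟩
  countTrue {n} (λ w → ⌊ toℕ w ≟ℕ c ⌋)           ≤⟨ countTrue-≟ {n} c ⟩
  1                                              ∎
  where
  open ≤-Reasoning
  ≟-suc : ∀ x → ⌊ suc x ≟ℕ suc c ⌋ ≡ ⌊ x ≟ℕ c ⌋
  ≟-suc x with x ≟ℕ c
  ... | yes refl = ⌊⌋-true (suc x ≟ℕ suc x) refl
  ... | no x≢c = ⌊⌋-false (suc x ≟ℕ suc c) (x≢c ∘ suc-injective)

countTrue-image : ∀ {n} (f : ℕ → ℕ) K → countTrue {n} (λ w → ⌊ anyUpTo? (λ k → toℕ w ≟ℕ f k) K ⌋) ≤ K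
countTrue-image {n} f zero = ≤-reflexive (countTrue-false {n})
countTrue-image {n} f (suc K) =
  ≤-trans (countTrue-≤-∨ {n} split) (+-mono-≤ (countTrue-≟ {n} (f K)) (countTrue-image {n} f K))
  where
  split : ∀ w → ⌊ anyUpTo? (λ k → toℕ w ≟ℕ f k) (suc K) ⌋ ≡ true →
          ⌊ toℕ w ≟ℕ f K ⌋ ≡ true ⊎ ⌊ anyUpTo? (λ k → toℕ w ≟ℕ f k) K ⌋ ≡ true
  split w h with ⌊⌋-true⁻¹ (anyUpTo? (λ k → toℕ w ≟ℕ f k) (suc K)) h
  ... | k , k<1+K , e with k ≟ℕ K
  ...   | yes refl = inj₁ (⌊⌋-true (toℕ w ≟ℕ f K) e)
  ...   | no k≢K = inj₂ (⌊⌋-true (anyUpTo? (λ k → toℕ w ≟ℕ f k) K) (k , ≤∧≢⇒< (≤-pred k<1+K) k≢K , e))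

⊑-trans : ∀ {k l n} {F : Adj k} {B : Adj l} {A : Adj n} → F ⊑ B → B ⊑ A → F ⊑ A
⊑-trans (f , f-inj , f-hom) (g , g-inj , g-hom) =
  (λ x → g (f x)) , (λ e → f-inj (g-inj e)) , (λ u v e → g-hom _ _ (f-hom u v e))

embedding? : ∀ {k n} (F : Adj k) (A : Adj n) (f : Fin k → Fin n) →
  Dec ((∀ a b → f a ≡ f b → a ≡ b) × (∀ a b → F a b ≡ true → A (f a) (f b) ≡ true))
embedding? F A f =
  all? (λ a → all? λ b → (f a ≟ f b) →-dec (a ≟ b)) ×-dec
  all? (λ a → all? λ b → (F a b Boolₚ.≟ true) →-dec (A (f a) (f b) Boolₚ.≟ true))

⊑-by-computation : ∀ {k n} {F : Adj k} {A : Adj n} (f : Fin k → Fin n) →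
  True (embedding? F A f) → F ⊑ A
⊑-by-computation {F = F} {A} f ok =
  let (inj , hom) = toWitness {a? = embedding? F A f} ok in f , (λ {a} {b} → inj a b) , hom

≢-image : ∀ {A B : Set} {f : A → B} → Injective _≡_ _≡_ f → ∀ {a b} → a ≢ b → f a ≢ f b
≢-image f-inj a≢b e = a≢b (f-inj e)

triple : ∀ {n} → Fin n → Fin n → Fin n → Fin 3 → Fin n
triple x y z 0F = x
triple x y z 1F = y
triple x y z 2F = z

triple-injective : ∀ {n} {x y z : Fin n} → x ≢ y → y ≢ z → x ≢ z → Injective _≡_ _≡_ (triple x y z)
triple-injective x≢y y≢z x≢z {0F} {0F} _ = refl
triple-injective x≢y y≢z x≢z {0F} {1F} e = contradiction e x≢y
triple-injective x≢y y≢z x≢z {0F} {2F} e = contradiction e x≢z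
triple-injective x≢y y≢z x≢z {1F} {0F} e = contradiction (sym e) x≢y
triple-injective x≢y y≢z x≢z {1F} {1F} _ = refl
triple-injective x≢y y≢z x≢z {1F} {2F} e = contradiction e y≢z
triple-injective x≢y y≢z x≢z {2F} {0F} e = contradiction (sym e) x≢z
triple-injective x≢y y≢z x≢z {2F} {1F} e = contradiction (sym e) y≢z
triple-injective x≢y y≢z x≢z {2F} {2F} _ = refl

SameEdge : ∀ {n} → Fin n → Fin n → Fin n → Fin n → Set
SameEdge x y c d = (c ≡ x × d ≡ y) ⊎ (c ≡ y × d ≡ x)

module _ {n} (A : Adj n) {x y : Fin n} where

  addEdge⁻¹ : ∀ {c d} → addEdge A x y c d ≡ true → A c d ≡ true ⊎ SameEdge x y c d
  addEdge⁻¹ {c} {d} h with ∨-true⁻¹ (A c d) h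
  ... | inj₁ old = inj₁ old
  ... | inj₂ new with ∨-true⁻¹ (⌊ c ≟ x ⌋ ∧ ⌊ d ≟ y ⌋) new
  ...   | inj₁ xy = let (c≡x , d≡y) = ∧-true⁻¹ _ xy in
                    inj₂ (inj₁ (⌊⌋-true⁻¹ (c ≟ x) c≡x , ⌊⌋-true⁻¹ (d ≟ y) d≡y))
  ...   | inj₂ yx = let (c≡y , d≡x) = ∧-true⁻¹ _ yx in
                    inj₂ (inj₂ (⌊⌋-true⁻¹ (c ≟ y) c≡y , ⌊⌋-true⁻¹ (d ≟ x) d≡x))

  addEdge-old : ∀ {c d} → A c d ≡ true → addEdge A x y c d ≡ true
  addEdge-old h = ∨-trueˡ _ h

  addEdge-new : ∀ {c d} → SameEdge x y c d → addEdge A x y c d ≡ true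
  addEdge-new {c} {d} (inj₁ (refl , refl))
    rewrite ⌊⌋-true (c ≟ c) refl | ⌊⌋-true (d ≟ d) refl = ∨-trueʳ (A c d) refl
  addEdge-new {c} {d} (inj₂ (refl , refl))
    rewrite ⌊⌋-true (c ≟ c) refl | ⌊⌋-true (d ≟ d) refl = ∨-trueʳ (A c d) (∨-trueʳ (⌊ c ≟ d ⌋ ∧ ⌊ d ≟ c ⌋) refl)

addEdge-mono : ∀ {k n} {F : Adj k} {A : Adj n} ((f , _) : F ⊑ A) {x y} → addEdge F x y ⊑ addEdge A (f x) (f y)
addEdge-mono {F = F} {A} (f , f-inj , f-hom) = f , f-inj , hom
  where
  hom : ∀ {x y} c d → addEdge F x y c d ≡ true → addEdge A (f x) (f y) (f c) (f d) ≡ true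
  hom c d h with addEdge⁻¹ F h
  ... | inj₁ old = addEdge-old A (f-hom c d old)
  ... | inj₂ (inj₁ (refl , refl)) = addEdge-new A (inj₁ (refl , refl))
  ... | inj₂ (inj₂ (refl , refl)) = addEdge-new A (inj₂ (refl , refl))

addEdge-graph : ∀ {n} (G : Graph n) {x y} → x ≢ y → Graph n
addEdge-graph G {x} {y} x≢y = record { adj = addEdge (adj G) x y ; sym = symmetric ; irrefl = irreflexive }
  where
  symmetric : ∀ c d → addEdge (adj G) x y c d ≡ addEdge (adj G) x y d c
  symmetric c d = cong₂ _∨_ (Graph.sym G c d) (trans (Boolₚ.∨-comm (⌊ c ≟ x ⌋ ∧ ⌊ d ≟ y ⌋) _)
    (cong₂ _∨_ (Boolₚ.∧-comm ⌊ c ≟ y ⌋ ⌊ d ≟ x ⌋) (Boolₚ.∧-comm ⌊ c ≟ x ⌋ ⌊ d ≟ y ⌋)))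
  irreflexive : ∀ c → addEdge (adj G) x y c c ≡ false
  irreflexive c rewrite Graph.irrefl G c with c ≟ x | c ≟ y
  ... | yes refl | yes refl = contradiction refl x≢y
  ... | yes _    | no _     = refl
  ... | no _     | yes _    = refl
  ... | no _     | no _     = refl

path₃ : Adj 3
path₃ 0F 1F = true
path₃ 1F 0F = true
path₃ 1F 2F = true
path₃ 2F 1F = true
path₃ _  _  = false

module _ {n} (G : Graph n) where
  private A = adj G

  adj-sym : ∀ {u v} → A u v ≡ true → A v u ≡ true
  adj-sym {u} {v} h = trans (Graph.sym G v u) h

  adj⇒≢ : ∀ {u v} → A u v ≡ true → u ≢ v
  adj⇒≢ {u} h refl with trans (sym h) (Graph.irrefl G u)
  ... | ()

  triangle⇒K3⊑ : ∀ {p q r} → A p q ≡ true → A q r ≡ true → A p r ≡ true → adj K3 ⊑ A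
  triangle⇒K3⊑ {p} {q} {r} pq qr pr = triple p q r , triple-injective (adj⇒≢ pq) (adj⇒≢ qr) (adj⇒≢ pr) , hom
    where
    hom : ∀ a b → adj K3 a b ≡ true → A (triple p q r a) (triple p q r b) ≡ true
    hom 0F 1F _ = pq
    hom 0F 2F _ = pr
    hom 1F 0F _ = adj-sym pq
    hom 1F 2F _ = qr
    hom 2F 0F _ = adj-sym pr
    hom 2F 1F _ = adj-sym qr

  path⇒path₃⊑ : ∀ {u w v} → A u w ≡ true → A w v ≡ true → u ≢ v → path₃ ⊑ A
  path⇒path₃⊑ {u} {w} {v} uw wv u≢v = triple u w v , triple-injective (adj⇒≢ uw) (adj⇒≢ wv) u≢v , hom
    where
    hom : ∀ a b → path₃ a b ≡ true → A (triple u w v a) (triple u w v b) ≡ true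
    hom 0F 1F _ = uw
    hom 1F 0F _ = adj-sym uw
    hom 1F 2F _ = wv
    hom 2F 1F _ = adj-sym wv

  module _ {u v : Fin n} (u≢v : u ≢ v) where

    private
      old-edge : ∀ {p q r} → SameEdge u v p q → r ≢ p → r ≢ q → addEdge A u v p r ≡ true → A p r ≡ true
      old-edge pq r≢p r≢q h with addEdge⁻¹ A h
      ... | inj₁ old = old
      old-edge (inj₁ (refl , refl)) r≢p r≢q h | inj₂ (inj₁ (_ , refl)) = contradiction refl r≢q
      old-edge (inj₂ (refl , refl)) r≢p r≢q h | inj₂ (inj₁ (refl , _)) = contradiction refl u≢v
      old-edge (inj₁ (refl , refl)) r≢p r≢q h | inj₂ (inj₂ (refl , _)) = contradiction refl u≢v
      old-edge (inj₂ (refl , refl)) r≢p r≢q h | inj₂ (inj₂ (_ , refl)) = contradiction refl r≢q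

      apex : ∀ {p q r} → SameEdge u v p q → r ≢ p → r ≢ q →
             addEdge A u v p r ≡ true → addEdge A u v q r ≡ true → ∃[ w ] A u w ≡ true × A w v ≡ true
      apex {p} {q} {r} pq r≢p r≢q pr qr with old-edge pq r≢p r≢q pr | old-edge (swap pq) r≢q r≢p qr
        where
        swap : SameEdge u v p q → SameEdge u v q p
        swap (inj₁ (p≡u , q≡v)) = inj₂ (q≡v , p≡u)
        swap (inj₂ (p≡v , q≡u)) = inj₁ (q≡u , p≡v)
      ... | A-pr | A-qr with pq
      ...   | inj₁ (refl , refl) = r , A-pr , adj-sym A-qr
      ...   | inj₂ (refl , refl) = r , A-qr , adj-sym A-pr

    -- a copy of K₃ in G + uv uses the new edge uv, and its third vertex is a common neighbour
    K3-saturated⇒common-neighbour : Saturated (adj K3) A → A u v ≡ false →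
                                    ∃[ w ] A u w ≡ true × A w v ≡ true
    K3-saturated⇒common-neighbour (noK3 , sat) uv with sat u v u≢v uv
    ... | (g , g-inj , g-hom)
      with addEdge⁻¹ A (g-hom 0F 1F refl) | addEdge⁻¹ A (g-hom 1F 2F refl) | addEdge⁻¹ A (g-hom 0F 2F refl)
    ... | inj₂ new | _ | _ =
      apex new (≢-image g-inj λ ()) (≢-image g-inj λ ()) (g-hom 0F 2F refl) (g-hom 1F 2F refl)
    ... | inj₁ _ | inj₂ new | _ =
      apex new (≢-image g-inj λ ()) (≢-image g-inj λ ()) (g-hom 1F 0F refl) (g-hom 2F 0F refl)
    ... | inj₁ _ | inj₁ _ | inj₂ new =
      apex new (≢-image g-inj λ ()) (≢-image g-inj λ ()) (g-hom 0F 1F refl) (g-hom 2F 1F refl)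
    ... | inj₁ e01 | inj₁ e12 | inj₁ e02 =
      contradiction (triangle⇒K3⊑ e01 e12 e02) noK3

-- The blow-up G[K₂]

blowK2′ : ∀ {n} → Adj n → Fin n × Fin 2 → Fin n × Fin 2 → Bool
blowK2′ A (u , i) (v , j) = (⌊ u ≟ v ⌋ ∧ not ⌊ i ≟ j ⌋) ∨ A u v

blowK2-remQuot : ∀ {n} (A : Adj n) x y → blowK2 A x y ≡ blowK2′ A (remQuot {n} 2 x) (remQuot {n} 2 y)
blowK2-remQuot {n} A x y with remQuot {n} 2 x | remQuot {n} 2 y
... | _ | _ = refl

blowK2-combine : ∀ {n} (A : Adj n) u i v j → blowK2 A (combine u i) (combine v j) ≡ blowK2′ A (u , i) (v , j)
blowK2-combine A u i v j =
  trans (blowK2-remQuot A _ _) (cong₂ (blowK2′ A) (remQuot-combine u i) (remQuot-combine v j))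

blowK2-graph : ∀ {n} → Graph n → Graph (n * 2)
blowK2-graph {n} G = record { adj = blowK2 (adj G) ; sym = symmetric ; irrefl = irreflexive }
  where
  symmetric : ∀ x y → blowK2 (adj G) x y ≡ blowK2 (adj G) y x
  symmetric x y = trans (blowK2-remQuot (adj G) x y) (trans (sym′ _ _) (sym (blowK2-remQuot (adj G) y x)))
    where
    sym′ : ∀ p q → blowK2′ (adj G) p q ≡ blowK2′ (adj G) q p
    sym′ (u , i) (v , j) rewrite ≟-sym u v | ≟-sym i j | Graph.sym G u v = refl
  irreflexive : ∀ x → blowK2 (adj G) x x ≡ false
  irreflexive x = trans (blowK2-remQuot (adj G) x x) (irrefl′ _)
    where
    irrefl′ : ∀ p → blowK2′ (adj G) p p ≡ false
    irrefl′ (u , i) rewrite ⌊⌋-true (u ≟ u) refl | ⌊⌋-true (i ≟ i) refl = Graph.irrefl G u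

module _ {n} (A : Adj n) where

  base : Fin (n * 2) → Fin n
  base x = proj₁ (remQuot {n} 2 x)

  blowK2-edge : ∀ {x y} → blowK2 A x y ≡ true → base x ≡ base y ⊎ A (base x) (base y) ≡ true
  blowK2-edge {x} {y} h = edge′ (remQuot {n} 2 x) (remQuot {n} 2 y) (trans (sym (blowK2-remQuot A x y)) h)
    where
    edge′ : ∀ p q → blowK2′ A p q ≡ true → proj₁ p ≡ proj₁ q ⊎ A (proj₁ p) (proj₁ q) ≡ true
    edge′ (u , i) (v , j) h with ∨-true⁻¹ (⌊ u ≟ v ⌋ ∧ not ⌊ i ≟ j ⌋) h
    ... | inj₁ same = inj₁ (⌊⌋-true⁻¹ (u ≟ v) (proj₁ (∧-true⁻¹ _ same)))
    ... | inj₂ edge = inj₂ edge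

  fibre-size≤2 : ∀ {x y z} → x ≢ y → x ≢ z → y ≢ z → base x ≡ base y → base x ≡ base z → ⊥
  fibre-size≤2 {x} {y} {z} x≢y x≢z y≢z xy xz =
    pigeonhole (proj₂ (remQuot {n} 2 x)) (proj₂ (remQuot {n} 2 y)) (proj₂ (remQuot {n} 2 z))
      (≢-fibre x≢y xy) (≢-fibre x≢z xz) (≢-fibre y≢z (trans (sym xy) xz))
    where
    ≢-fibre : ∀ {x y} → x ≢ y → base x ≡ base y → proj₂ (remQuot {n} 2 x) ≢ proj₂ (remQuot {n} 2 y)
    ≢-fibre {x} {y} x≢y bxy ixy = x≢y (begin
      x                                 ≡⟨ combine-remQuot {n} 2 x ⟨
      uncurry combine (remQuot {n} 2 x) ≡⟨ cong₂ combine bxy ixy ⟩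
      uncurry combine (remQuot {n} 2 y) ≡⟨ combine-remQuot {n} 2 y ⟩
      y                                 ∎)
      where open ≡-Reasoning
    pigeonhole : (i j k : Fin 2) → i ≢ j → i ≢ k → j ≢ k → ⊥
    pigeonhole 0F 0F _ i≢j _ _ = i≢j refl
    pigeonhole 1F 1F _ i≢j _ _ = i≢j refl
    pigeonhole 0F 1F 0F _ i≢k _ = i≢k refl
    pigeonhole 0F 1F 1F _ _ j≢k = j≢k refl
    pigeonhole 1F 0F 0F _ _ j≢k = j≢k refl
    pigeonhole 1F 0F 1F _ i≢k _ = i≢k refl

  blowK2′-fibre : ∀ {u i j} → i ≢ j → blowK2′ A (u , i) (u , j) ≡ true
  blowK2′-fibre {u} {i} {j} i≢j rewrite ⌊⌋-true (u ≟ u) refl | ⌊⌋-false (i ≟ j) i≢j = refl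

  blowK2′-edge : ∀ {u i v j} → A u v ≡ true → blowK2′ A (u , i) (v , j) ≡ true
  blowK2′-edge h = ∨-trueʳ _ h

module _ {n} (G : Graph n) where
  private
    A = adj G
    B = blowK2 A

    fibre-degree : ∀ u i v → sum (λ j → 𝟙 (B (combine u i) (combine v j))) ≡ 𝟙 (A u v) + 𝟙 (A u v) + 𝟙 ⌊ u ≟ v ⌋
    fibre-degree u i v rewrite blowK2-combine A u i v 0F | blowK2-combine A u i v 1F with u ≟ v
    ... | no _ = sym (+-assoc (𝟙 (A u v)) _ _)
    fibre-degree u 0F v | yes refl rewrite Graph.irrefl G u = refl
    fibre-degree u 1F v | yes refl rewrite Graph.irrefl G u = refl

  blowK2-degree : ∀ u i → degree B (combine u i) ≡ degree A u + degree A u + 1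
  blowK2-degree u i = begin
    degree B (combine u i)                                          ≡⟨ countTrue≡sum (B (combine u i)) ⟩
    sum (𝟙 ∘ B (combine u i))                                        ≡⟨ sum-combine n 2 _ ⟩
    sum {n} (λ v → sum (λ j → 𝟙 (B (combine u i) (combine v j))))    ≡⟨ sum-cong-≗ {n} (fibre-degree u i) ⟩
    sum {n} (λ v → 𝟙 (A u v) + 𝟙 (A u v) + 𝟙 ⌊ u ≟ v ⌋)              ≡⟨ ∑-distrib-+ {n} _ _ ⟩
    sum {n} (λ v → 𝟙 (A u v) + 𝟙 (A u v)) + sum (λ v → 𝟙 ⌊ u ≟ v ⌋) ≡⟨ cong₂ _+_ (∑-distrib-+ {n} _ _) (sum-δ u) ⟩
    sum (𝟙 ∘ A u) + sum (𝟙 ∘ A u) + 1                               ≡⟨ cong (λ d → d + d + 1) (countTrue≡sum (A u)) ⟨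
    degree A u + degree A u + 1                                     ∎
    where open ≡-Reasoning

  blowK2-regular : Regular A → Regular B
  blowK2-regular (d , deg≡d) = d + d + 1 , deg
    where
    deg : ∀ x → degree B x ≡ d + d + 1
    deg x with combine-surjective {n} {2} x
    ... | (u , i , refl) = trans (blowK2-degree u i) (cong (λ e → e + e + 1) (deg≡d u))

F6-rotation : adj F6 ⊑ adj F6
F6-rotation = ⊑-by-computation {F = adj F6} {A = adj F6} ρ _
  where
  ρ : Fin 6 → Fin 6
  ρ 0F = 1F
  ρ 1F = 2F
  ρ 2F = 0F
  ρ 3F = 4F
  ρ 4F = 5F
  ρ 5F = 3F

module _ {n} (G : Graph n) (noK3 : ¬ (adj K3 ⊑ adj G)) where
  private
    A = adj G
    B = blowK2 A

  blowK2-triangle : ∀ {x y z} → B x y ≡ true → B y z ≡ true → B x z ≡ true →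
                    base A x ≡ base A y ⊎ base A y ≡ base A z ⊎ base A x ≡ base A z
  blowK2-triangle xy yz xz with blowK2-edge A xy | blowK2-edge A yz | blowK2-edge A xz
  ... | inj₁ e | _ | _ = inj₁ e
  ... | inj₂ _ | inj₁ e | _ = inj₂ (inj₁ e)
  ... | inj₂ _ | inj₂ _ | inj₁ e = inj₂ (inj₂ e)
  ... | inj₂ e₁ | inj₂ e₂ | inj₂ e₃ =
    contradiction (triangle⇒K3⊑ G e₁ e₂ e₃) noK3

  private
    fibre₃ : ∀ {k} {f : Fin k → Fin (n * 2)} → Injective _≡_ _≡_ f → ∀ {a b c} → a ≢ b → a ≢ c → b ≢ c →
             base A (f a) ≡ base A (f b) → base A (f a) ≡ base A (f c) → ⊥
    fibre₃ f-inj a≢b a≢c b≢c = fibre-size≤2 A (≢-image f-inj a≢b) (≢-image f-inj a≢c) (≢-image f-inj b≢c)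

    -- if a and b share a fibre, the triangles bce (1 2 4) and acf (0 2 5) put three vertices into one fibre
    base-a≢base-b : ((f , _) : adj F6 ⊑ B) → base A (f 0F) ≢ base A (f 1F)
    base-a≢base-b (f , f-inj , f-hom) ab
      with blowK2-triangle (f-hom 1F 2F refl) (f-hom 2F 4F refl) (f-hom 1F 4F refl)
         | blowK2-triangle (f-hom 0F 2F refl) (f-hom 2F 5F refl) (f-hom 0F 5F refl)
    ... | inj₁ bc | _ = fibre₃ f-inj {0F} {1F} {2F} (λ ()) (λ ()) (λ ()) ab (trans ab bc)
    ... | inj₂ (inj₂ be) | _ = fibre₃ f-inj {0F} {1F} {4F} (λ ()) (λ ()) (λ ()) ab (trans ab be)
    ... | inj₂ (inj₁ ce) | inj₁ ac = fibre₃ f-inj {0F} {1F} {2F} (λ ()) (λ ()) (λ ()) ab ac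
    ... | inj₂ (inj₁ ce) | inj₂ (inj₁ cf) = fibre₃ f-inj {2F} {4F} {5F} (λ ()) (λ ()) (λ ()) ce cf
    ... | inj₂ (inj₁ ce) | inj₂ (inj₂ af) = fibre₃ f-inj {0F} {1F} {5F} (λ ()) (λ ()) (λ ()) ab af

    rotate : adj F6 ⊑ B → adj F6 ⊑ B
    rotate = ⊑-trans {F = adj F6} {B = adj F6} {A = B} F6-rotation

  -- two vertices of the central triangle abc share a fibre; rotating F₆ makes them a and b
  F6⋢blowK2 : ¬ (adj F6 ⊑ B)
  F6⋢blowK2 f@(g , _ , g-hom)
    with blowK2-triangle (g-hom 0F 1F refl) (g-hom 1F 2F refl) (g-hom 0F 2F refl)
  ... | inj₁ ab = base-a≢base-b f ab
  ... | inj₂ (inj₁ bc) = base-a≢base-b (rotate f) bc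
  ... | inj₂ (inj₂ ac) = base-a≢base-b (rotate (rotate f)) (sym ac)

_⊕_ : Fin 2 → Fin 2 → Fin 2
0F ⊕ j  = j
1F ⊕ 0F = 1F
1F ⊕ 1F = 0F

⊕-cancelʳ : ∀ {i i′} j → i ⊕ j ≡ i′ ⊕ j → i ≡ i′
⊕-cancelʳ {0F} {0F} _ _ = refl
⊕-cancelʳ {0F} {1F} 0F ()
⊕-cancelʳ {0F} {1F} 1F ()
⊕-cancelʳ {1F} {0F} 0F ()
⊕-cancelʳ {1F} {0F} 1F ()
⊕-cancelʳ {1F} {1F} _ _ = refl

-- τ β decides which vertex of the image fibre receives (β , 0F)
blowK2-mono : ∀ {k n} {F : Adj k} {A : Adj n} → F ⊑ A → (τ : Fin k → Fin 2) → blowK2 F ⊑ blowK2 A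
blowK2-mono {k} {n} {F} {A} (g , g-inj , g-hom) τ = h′ ∘ remQuot {k} 2 , h-inj , h-hom
  where
  h′ : Fin k × Fin 2 → Fin (n * 2)
  h′ (β , c) = combine (g β) (c ⊕ τ β)
  h′-inj : ∀ p q → h′ p ≡ h′ q → p ≡ q
  h′-inj (β , c) (β′ , c′) e with g-inj (combine-injectiveˡ (g β) (c ⊕ τ β) (g β′) (c′ ⊕ τ β′) e)
  ... | refl = cong (β ,_) (⊕-cancelʳ (τ β) (combine-injectiveʳ (g β) (c ⊕ τ β) (g β) (c′ ⊕ τ β) e))
  h-inj : Injective _≡_ _≡_ (h′ ∘ remQuot {k} 2)
  h-inj {x} {y} e = begin
    x                                 ≡⟨ combine-remQuot {k} 2 x ⟨
    uncurry combine (remQuot {k} 2 x) ≡⟨ cong (uncurry combine) (h′-inj _ _ e) ⟩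
    uncurry combine (remQuot {k} 2 y) ≡⟨ combine-remQuot {k} 2 y ⟩
    y                                 ∎
    where open ≡-Reasoning
  h′-hom : ∀ p q → blowK2′ F p q ≡ true → blowK2 A (h′ p) (h′ q) ≡ true
  h′-hom (β , c) (β′ , c′) e rewrite blowK2-combine A (g β) (c ⊕ τ β) (g β′) (c′ ⊕ τ β′)
    with ∨-true⁻¹ (⌊ β ≟ β′ ⌋ ∧ not ⌊ c ≟ c′ ⌋) e
  ... | inj₂ edge = blowK2′-edge A (g-hom β β′ edge)
  ... | inj₁ same with ∧-true⁻¹ _ same
  ...   | β≡β′ , c≢c′ with ⌊⌋-true⁻¹ (β ≟ β′) β≡β′
  ...     | refl = blowK2′-fibre A (λ e → ⌊⌋-not⁻¹ (c ≟ c′) c≢c′ (⊕-cancelʳ (τ β) e))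
  h-hom : ∀ x y → blowK2 F x y ≡ true → blowK2 A (h′ (remQuot {k} 2 x)) (h′ (remQuot {k} 2 y)) ≡ true
  h-hom x y e = h′-hom _ _ (trans (sym (blowK2-remQuot F x y)) e)

K3'2⊑path₃[K₂]+edge : adj K3'2 ⊑ addEdge (blowK2 path₃) 0F 4F
K3'2⊑path₃[K₂]+edge = ⊑-by-computation {F = adj K3'2} {A = addEdge (blowK2 path₃) 0F 4F} (λ x → x) _

module _ {n} (G : Graph n) (sat : Saturated (adj K3) (adj G)) where
  private
    A = adj G
    B = blowK2 A

  blowK2-completes-K3'2 : ∀ x y → x ≢ y → B x y ≡ false → adj K3'2 ⊑ addEdge B x y
  blowK2-completes-K3'2 x y x≢y xy
    with combine-surjective {n} {2} x | combine-surjective {n} {2} y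
  ... | (u , i , refl) | (v , j , refl) = via (K3-saturated⇒common-neighbour G u≢v sat uv)
    where
    xy′ : blowK2′ A (u , i) (v , j) ≡ false
    xy′ = trans (sym (blowK2-combine A u i v j)) xy
    u≢v : u ≢ v
    u≢v refl with i ≟ j
    ... | yes refl = x≢y refl
    ... | no i≢j = contradiction (trans (sym (blowK2′-fibre A i≢j)) xy′) λ ()
    uv : A u v ≡ false
    uv = Boolₚ.¬-not λ e → contradiction (trans (sym (blowK2′-edge A e)) xy′) λ ()
    via : ∃[ w ] A u w ≡ true × A w v ≡ true → adj K3'2 ⊑ addEdge B (combine u i) (combine v j)
    via (w , uw , wv) =
      ⊑-trans {F = adj K3'2} {B = addEdge (blowK2 path₃) 0F 4F} {A = addEdge B (combine u i) (combine v j)}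
        K3'2⊑path₃[K₂]+edge (addEdge-mono {F = blowK2 path₃} {A = B} path[K₂])
      where
      path[K₂] : blowK2 path₃ ⊑ B
      path[K₂] = blowK2-mono {F = path₃} {A = A} (path⇒path₃⊑ G uw wv u≢v) (triple i 0F j)

blowK2-saturated : ∀ {n k} (G : Graph n) → Saturated (adj K3) (adj G) →
                   (F : Adj k) → adj F6 ⊑ F → F ⊑ adj K3'2 → Saturated F (blowK2 (adj G))
blowK2-saturated G sat@(noK3 , _) F F6⊑F F⊑K3'2 =
  (λ F⊑B → F6⋢blowK2 G noK3 (⊑-trans {F = adj F6} {B = F} {A = blowK2 (adj G)} F6⊑F F⊑B)) ,
  (λ x y x≢y xy → ⊑-trans {F = F} {B = adj K3'2} {A = addEdge (blowK2 (adj G)) x y}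
                    F⊑K3'2 (blowK2-completes-K3'2 G sat x y x≢y xy))

-- Congruence modulo m

infix 4 _≡_mod_
_≡_mod_ : ℕ → ℕ → ℕ → Set
x ≡ y mod m = ∃₂ λ k l → x + k * m ≡ y + l * m

module _ {m : ℕ} where

  ≡⇒≡-mod : ∀ {x y} → x ≡ y → x ≡ y mod m
  ≡⇒≡-mod refl = 0 , 0 , refl

  mod-sym : ∀ {x y} → x ≡ y mod m → y ≡ x mod m
  mod-sym (k , l , e) = l , k , sym e

  mod-trans : ∀ {x y z} → x ≡ y mod m → y ≡ z mod m → x ≡ z mod m
  mod-trans {x} {y} {z} (k , l , e) (k′ , l′ , e′) = k + k′ , l′ + l , (begin
    x + (k + k′) * m   ≡⟨ solve (x ∷ k ∷ k′ ∷ m ∷ []) ⟩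
    x + k * m + k′ * m ≡⟨ cong (_+ k′ * m) e ⟩
    y + l * m + k′ * m ≡⟨ solve (y ∷ l ∷ k′ ∷ m ∷ []) ⟩
    y + k′ * m + l * m ≡⟨ cong (_+ l * m) e′ ⟩
    z + l′ * m + l * m ≡⟨ solve (z ∷ l′ ∷ l ∷ m ∷ []) ⟩
    z + (l′ + l) * m   ∎)
    where open ≡-Reasoning

  mod-setoid : Setoid _ _
  mod-setoid = record
    { Carrier = ℕ
    ; _≈_ = (_≡_mod m)
    ; isEquivalence = record { refl = ≡⇒≡-mod refl ; sym = mod-sym ; trans = mod-trans }
    }

  mod-+ : ∀ {x y x′ y′} → x ≡ y mod m → x′ ≡ y′ mod m → x + x′ ≡ y + y′ mod m
  mod-+ {x} {y} {x′} {y′} (k , l , e) (k′ , l′ , e′) = k + k′ , l + l′ , (begin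
    x + x′ + (k + k′) * m       ≡⟨ solve (x ∷ x′ ∷ k ∷ k′ ∷ m ∷ []) ⟩
    (x + k * m) + (x′ + k′ * m) ≡⟨ cong₂ _+_ e e′ ⟩
    (y + l * m) + (y′ + l′ * m) ≡⟨ solve (y ∷ y′ ∷ l ∷ l′ ∷ m ∷ []) ⟩
    y + y′ + (l + l′) * m       ∎)
    where open ≡-Reasoning

  mod-cancelˡ : ∀ a {x y} → a + x ≡ a + y mod m → x ≡ y mod m
  mod-cancelˡ a {x} {y} (k , l , e) = k , l , +-cancelˡ-≡ a _ _ (begin
    a + (x + k * m) ≡⟨ +-assoc a x _ ⟨
    a + x + k * m   ≡⟨ e ⟩
    a + y + l * m   ≡⟨ +-assoc a y _ ⟩
    a + (y + l * m) ∎)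
    where open ≡-Reasoning

  m≡0 : m ≡ 0 mod m
  m≡0 = 0 , 1 , refl

  mod-cycle₂ : ∀ {a b x y} → a + x ≡ b mod m → b + y ≡ a mod m → x + y ≡ 0 mod m
  mod-cycle₂ {a} {b} {x} {y} ax≡b by≡a = mod-cancelˡ a (begin
    a + (x + y) ≡⟨ +-assoc a x y ⟨
    a + x + y   ≈⟨ mod-+ ax≡b (≡⇒≡-mod refl) ⟩
    b + y       ≈⟨ by≡a ⟩
    a           ≡⟨ +-identityʳ a ⟨
    a + 0       ∎)
    where open ≈-Reasoning mod-setoid

  mod-cycle₃ : ∀ {a b c x y z} → a + x ≡ b mod m → b + y ≡ c mod m → c + z ≡ a mod m → x + y + z ≡ 0 mod m
  mod-cycle₃ {a} {b} {c} {x} {y} {z} ax≡b by≡c cz≡a = mod-cancelˡ a (begin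
    a + (x + y + z) ≡⟨ solve (a ∷ x ∷ y ∷ z ∷ []) ⟩
    a + x + y + z   ≈⟨ mod-+ (mod-+ ax≡b (≡⇒≡-mod refl)) (≡⇒≡-mod refl) ⟩
    b + y + z       ≈⟨ mod-+ by≡c (≡⇒≡-mod refl) ⟩
    c + z           ≈⟨ cz≡a ⟩
    a               ≡⟨ +-identityʳ a ⟨
    a + 0           ∎)
    where open ≈-Reasoning mod-setoid

  mod-detour : ∀ {a b c x y z} → a + x ≡ c mod m → x + y ≡ z mod m → a + z ≡ b mod m → c + y ≡ b mod m
  mod-detour {a} {b} {c} {x} {y} {z} ax≡c xy≡z az≡b = begin
    c + y       ≈⟨ mod-+ (mod-sym ax≡c) (≡⇒≡-mod refl) ⟩
    a + x + y   ≡⟨ +-assoc a x y ⟩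
    a + (x + y) ≈⟨ mod-+ (≡⇒≡-mod refl) xy≡z ⟩
    a + z       ≈⟨ az≡b ⟩
    b           ∎
    where open ≈-Reasoning mod-setoid

  mod0⇒multiple : ∀ {x} → x ≡ 0 mod m → ∃[ q ] x ≡ q * m
  mod0⇒multiple {x} (k , l , e) = l ∸ k , (begin
    x                 ≡⟨ m+n∸n≡m x (k * m) ⟨
    x + k * m ∸ k * m ≡⟨ cong (_∸ k * m) e ⟩
    l * m ∸ k * m     ≡⟨ *-distribʳ-∸ m l k ⟨
    (l ∸ k) * m       ∎)
    where open ≡-Reasoning

  module _ .{{_ : NonZero m}} where

    %-≡ : ∀ x → x ≡ x % m mod m
    %-≡ x = 0 , x / m , trans (+-identityʳ x) (m≡m%n+[m/n]*n x m)

    mod-unique : ∀ {x y} → x < m → y < m → x ≡ y mod m → x ≡ y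
    mod-unique {x} {y} x<m y<m (k , l , e) = begin
      x               ≡⟨ m<n⇒m%n≡m x<m ⟨
      x % m           ≡⟨ [m+kn]%n≡m%n x k m ⟨
      (x + k * m) % m ≡⟨ cong (_% m) e ⟩
      (y + l * m) % m ≡⟨ [m+kn]%n≡m%n y l m ⟩
      y % m           ≡⟨ m<n⇒m%n≡m y<m ⟩
      y               ∎
      where open ≡-Reasoning

  multiple-below : ∀ {x} k → x ≡ 0 mod m → x < k * m → ∃[ q ] q < k × x ≡ q * m
  multiple-below k x≡0 x<km with mod0⇒multiple x≡0
  ... | q , refl = q , *-cancelʳ-< m q k x<km , refl

  ≡+m⇒≡-mod : ∀ {x y} → x ≡ y + m → x ≡ y mod m
  ≡+m⇒≡-mod {x} {y} e = 0 , 1 , trans (+-identityʳ x) (trans e (cong (y +_) (sym (+-identityʳ m))))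

  mod0-below-2m : ∀ {x y} → x < m → y < m → x + y ≡ 0 mod m → x + y ≡ 0 ⊎ x + y ≡ m
  mod0-below-2m {x} {y} x<m y<m x+y≡0
    with multiple-below 2 x+y≡0 (subst (x + y <_) (cong (m +_) (sym (+-identityʳ m))) (+-mono-< x<m y<m))
  ... | 0 , _ , e = inj₁ e
  ... | 1 , _ , e = inj₂ (trans e (+-identityʳ m))
  ... | suc (suc _) , s≤s (s≤s ()) , _

-- Circulant graphs

-- the Cayley graph of ℤ/m with connection set S; residues are naturals below m, and S-neg says S = −S
module Circulant (m : ℕ) .{{_ : NonZero m}} (S : ℕ → Bool)
  (S-<m : ∀ {x} → S x ≡ true → x < m)
  (0∉S : S 0 ≡ false)
  (S-neg : ∀ {x y} → x + y ≡ m → S x ≡ true → S y ≡ true)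
  (S-sum-free : ∀ {x y z} → S x ≡ true → S y ≡ true → S z ≡ true → ¬ (x + y + z ≡ 0 mod m))
  (S-complete : ∀ {z} → 0 < z → z < m → S z ≡ false →
                ∃₂ λ x y → S x ≡ true × S y ≡ true × (x + y ≡ z mod m))
  where

  _+ₘ_ : Fin m → ℕ → Fin m
  u +ₘ x = fromℕ< (m%n<n (toℕ u + x) m)

  +ₘ-≡ : ∀ u x → toℕ u + x ≡ toℕ (u +ₘ x) mod m
  +ₘ-≡ u x = mod-trans (%-≡ (toℕ u + x)) (≡⇒≡-mod (sym (toℕ-fromℕ< _)))

  offset : Fin m → Fin m → ℕ
  offset u v = (toℕ v + (m ∸ toℕ u)) % m

  offset<m : ∀ u v → offset u v < m
  offset<m u v = m%n<n _ m

  offset-≡ : ∀ u v → toℕ u + offset u v ≡ toℕ v mod m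
  offset-≡ u v = begin
    toℕ u + offset u v              ≈⟨ mod-+ (≡⇒≡-mod refl) (mod-sym (%-≡ _)) ⟩
    toℕ u + (toℕ v + (m ∸ toℕ u))   ≡⟨ x∙yz≈y∙xz (toℕ u) (toℕ v) _ ⟩
    toℕ v + (toℕ u + (m ∸ toℕ u))   ≡⟨ cong (toℕ v +_) (m+[n∸m]≡n (<⇒≤ (toℕ<n u))) ⟩
    toℕ v + m                       ≈⟨ mod-+ (≡⇒≡-mod refl) m≡0 ⟩
    toℕ v + 0                       ≡⟨ +-identityʳ _ ⟩
    toℕ v                           ∎
    where open ≈-Reasoning (mod-setoid {m})

  offset-unique : ∀ {u v x} → toℕ u + x ≡ toℕ v mod m → x < m → offset u v ≡ x
  offset-unique {u} {v} {x} ux x<m =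
    mod-unique (offset<m u v) x<m (mod-cancelˡ (toℕ u) (mod-trans (offset-≡ u v) (mod-sym ux)))

  private
    0<m : 0 < m
    0<m = >-nonZero⁻¹ m

  offset-self : ∀ u → offset u u ≡ 0
  offset-self u = offset-unique {u} {u} (≡⇒≡-mod (+-identityʳ _)) 0<m

  offset≡0⇒≡ : ∀ {u v} → offset u v ≡ 0 → u ≡ v
  offset≡0⇒≡ {u} {v} uv≡0 = toℕ-injective (mod-unique (toℕ<n u) (toℕ<n v)
    (mod-trans (≡⇒≡-mod (sym (trans (cong (toℕ u +_) uv≡0) (+-identityʳ _)))) (offset-≡ u v)))

  offset-cycle₂ : ∀ u v → offset u v + offset v u ≡ 0 mod m
  offset-cycle₂ u v = mod-cycle₂ {a = toℕ u} {toℕ v} {offset u v} {offset v u} (offset-≡ u v) (offset-≡ v u)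

  offset-cycle₃ : ∀ u v w → offset u v + offset v w + offset w u ≡ 0 mod m
  offset-cycle₃ u v w = mod-cycle₃ {a = toℕ u} {toℕ v} {toℕ w} {offset u v} {offset v w} {offset w u}
    (offset-≡ u v) (offset-≡ v w) (offset-≡ w u)

  C : Adj m
  C u v = S (offset u v)

  C-sym : ∀ u v → C u v ≡ C v u
  C-sym u v = by-cases (mod0-below-2m (offset<m u v) (offset<m v u) (offset-cycle₂ u v))
    where
    by-cases : offset u v + offset v u ≡ 0 ⊎ offset u v + offset v u ≡ m → S (offset u v) ≡ S (offset v u)
    by-cases (inj₁ x+y≡0) = cong S (trans (m+n≡0⇒m≡0 (offset u v) x+y≡0) (sym (m+n≡0⇒n≡0 (offset u v) x+y≡0)))
    by-cases (inj₂ x+y≡m) = Bool-ext (S-neg x+y≡m) (S-neg (trans (+-comm (offset v u) (offset u v)) x+y≡m))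

  C-irrefl : ∀ u → C u u ≡ false
  C-irrefl u = trans (cong S (offset-self u)) 0∉S

  circulant : Graph m
  circulant = record { adj = C ; sym = C-sym ; irrefl = C-irrefl }

  C-degree : ∀ u → degree C u ≡ countTrue {m} (S ∘ toℕ)
  C-degree u = begin
    degree C u                               ≡⟨ countTrue≡sum (C u) ⟩
    sum {m} (λ v → 𝟙 (S (offset u v)))        ≡⟨ sum-cong-≗ {m} (λ v → cong (𝟙 ∘ S) (toℕ-fromℕ< (offset<m u v))) ⟨
    sum {m} (λ v → 𝟙 (S (toℕ (π ⟨$⟩ʳ v))))    ≡⟨ ∑-permute {m} (𝟙 ∘ S ∘ toℕ) π ⟨
    sum {m} (𝟙 ∘ S ∘ toℕ)                     ≡⟨ countTrue≡sum {m} (S ∘ toℕ) ⟨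
    countTrue {m} (S ∘ toℕ)                   ∎
    where
    open ≡-Reasoning
    π : Permutation m m
    π = permutation (λ v → fromℕ< (offset<m u v)) (λ w → u +ₘ toℕ w)
      (λ w → toℕ-injective (trans (toℕ-fromℕ< _) (offset-unique (+ₘ-≡ u (toℕ w)) (toℕ<n w))))
      (λ v → toℕ-injective (mod-unique (toℕ<n _) (toℕ<n v)
        (mod-trans (mod-sym (+ₘ-≡ u _)) (subst (λ x → toℕ u + x ≡ toℕ v mod m) (sym (toℕ-fromℕ< _)) (offset-≡ u v)))))

  C-regular : Regular C
  C-regular = countTrue {m} (S ∘ toℕ) , C-degree

  C-triangle-free : ¬ (adj K3 ⊑ C)
  C-triangle-free (g , _ , g-hom) =
    S-sum-free (g-hom 0F 1F refl) (g-hom 1F 2F refl) (g-hom 2F 0F refl)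
      (offset-cycle₃ (g 0F) (g 1F) (g 2F))

  C-saturated : Saturated (adj K3) C
  C-saturated = C-triangle-free , λ u v u≢v uv →
    third-vertex u≢v (S-complete (n≢0⇒n>0 (u≢v ∘ offset≡0⇒≡)) (offset<m u v) uv)
    where
    third-vertex : ∀ {u v} → u ≢ v → (∃₂ λ x y → S x ≡ true × S y ≡ true × (x + y ≡ offset u v mod m)) →
                         adj K3 ⊑ addEdge C u v
    third-vertex {u} {v} u≢v (x , y , Sx , Sy , x+y≡z) =
      triangle⇒K3⊑ (addEdge-graph circulant u≢v) {u} {v} {w}
        (addEdge-new C {u} {v} {u} {v} (inj₁ (refl , refl)))
        (addEdge-old C {u} {v} {v} {w} vw) (addEdge-old C {u} {v} {u} {w} uw)
      where
      w = u +ₘ x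
      offset-uw : offset u w ≡ x
      offset-uw = offset-unique (+ₘ-≡ u x) (S-<m Sx)
      offset-wv : offset w v ≡ y
      offset-wv = offset-unique (mod-detour {a = toℕ u} {toℕ v} {toℕ w} {x} {y} {offset u v}
                    (+ₘ-≡ u x) x+y≡z (offset-≡ u v)) (S-<m Sy)
      uw : C u w ≡ true
      uw = trans (cong S offset-uw) Sx
      vw : C v w ≡ true
      vw = trans (C-sym v w) (trans (cong S offset-wv) Sy)

-- A complete sum-free set

-- for 0 < x, y, z < m, x + y + z ≡ 0 (mod m) means that the sum is m or 2m
Wraps : ℕ → ℕ → Set
Wraps M X = X ≡ M ⊎ X ≡ M + M

mod0⇒wraps : ∀ {m X} → X ≡ 0 mod m → 0 < X → X < 3 * m → Wraps m X
mod0⇒wraps {m} X≡0 0<X X<3m with multiple-below 3 X≡0 X<3m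
... | 0 , _ , refl = contradiction 0<X λ ()
... | 1 , _ , refl = inj₁ (+-identityʳ m)
... | 2 , _ , refl = inj₂ (cong (m +_) (+-identityʳ m))
... | suc (suc (suc _)) , s≤s (s≤s (s≤s ())) , _

+<3* : ∀ {m x y z} → x < m → y < m → z < m → x + y + z < 3 * m
+<3* {m} {x} {y} {z} x<m y<m z<m =
  subst (x + y + z <_) (trans (+-assoc m m m) (cong (λ k → m + (m + k)) (sym (+-identityʳ m))))
    (+-mono-< (+-mono-< x<m y<m) z<m)

¬wraps-< : ∀ {M X} → X < M → ¬ Wraps M X
¬wraps-< X<M (inj₁ refl) = <-irrefl refl X<M
¬wraps-< {M} X<M (inj₂ refl) = <-irrefl refl (<-≤-trans X<M (m≤m+n M M))

odd+odd≢odd : ∀ i j k → suc (2 * i) + suc (2 * j) ≢ suc (2 * k)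
odd+odd≢odd i j k e = even≢odd (suc (i + j)) k (trans 2[1+i+j]≡ e)
  where
  2[1+i+j]≡ : 2 * suc (i + j) ≡ suc (2 * i) + suc (2 * j)
  2[1+i+j]≡ = solve (i ∷ j ∷ [])

c+s*x≢s*y : ∀ {s c X Y} → 0 < c → c < s → c + s * X ≢ s * Y
c+s*x≢s*y {s} {c} {X} {Y} 0<c c<s e with X <? Y
... | yes X<Y =
  <⇒≱ (+-monoˡ-< (s * X) c<s) (subst (s + s * X ≤_) (sym e) (subst (_≤ s * Y) (*-suc s X) (*-monoʳ-≤ s X<Y)))
... | no X≮Y = <⇒≱ (m<n+m (s * X) 0<c) (subst (_≤ s * X) (sym e) (*-monoʳ-≤ s (≮⇒≥ X≮Y)))

wraps-shift : ∀ {M X Δ R} → X + Δ ≡ M + R → Wraps M X → Δ ≡ R ⊎ M + Δ ≡ R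
wraps-shift {M} total (inj₁ refl) = inj₁ (+-cancelˡ-≡ M _ _ total)
wraps-shift {M} {Δ = Δ} total (inj₂ refl) = inj₂ (+-cancelˡ-≡ M _ _ (trans (sym (+-assoc M M Δ)) total))

module _ {M : ℕ} where
  open ≡-Reasoning

  ¬wraps-pos-pos-neg : ∀ o₁ o₂ x₃ o₃ → x₃ + o₃ ≡ M → o₁ + o₂ ≢ o₃ → o₁ + o₂ < M → ¬ Wraps M (o₁ + o₂ + x₃)
  ¬wraps-pos-pos-neg o₁ o₂ x₃ o₃ x₃+o₃≡M o₁+o₂≢o₃ o₁+o₂<M wraps with wraps-shift total wraps
    where
    total : o₁ + o₂ + x₃ + o₃ ≡ M + (o₁ + o₂)
    total = begin
      o₁ + o₂ + x₃ + o₃   ≡⟨ solve (o₁ ∷ o₂ ∷ x₃ ∷ o₃ ∷ []) ⟩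
      (x₃ + o₃) + (o₁ + o₂) ≡⟨ cong (_+ (o₁ + o₂)) x₃+o₃≡M ⟩
      M + (o₁ + o₂)       ∎
  ... | inj₁ e = o₁+o₂≢o₃ (sym e)
  ... | inj₂ e = <⇒≱ o₁+o₂<M (subst (M ≤_) e (m≤m+n M o₃))

  ¬wraps-pos-neg-neg : ∀ o₁ x₂ x₃ o₂ o₃ → x₂ + o₂ ≡ M → x₃ + o₃ ≡ M → o₂ + o₃ ≢ o₁ → o₂ + o₃ < M →
                       ¬ Wraps M (o₁ + x₂ + x₃)
  ¬wraps-pos-neg-neg o₁ x₂ x₃ o₂ o₃ x₂+o₂≡M x₃+o₃≡M o₂+o₃≢o₁ o₂+o₃<M wraps with wraps-shift total wraps
    where
    total : o₁ + x₂ + x₃ + (o₂ + o₃) ≡ M + (M + o₁)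
    total = begin
      o₁ + x₂ + x₃ + (o₂ + o₃)    ≡⟨ solve (o₁ ∷ x₂ ∷ x₃ ∷ o₂ ∷ o₃ ∷ []) ⟩
      (x₂ + o₂) + ((x₃ + o₃) + o₁) ≡⟨ cong₂ (λ p q → p + (q + o₁)) x₂+o₂≡M x₃+o₃≡M ⟩
      M + (M + o₁)                ∎
  ... | inj₁ e = <⇒≱ o₂+o₃<M (subst (M ≤_) (sym e) (m≤m+n M o₁))
  ... | inj₂ e = o₂+o₃≢o₁ (+-cancelˡ-≡ M _ _ e)

  ¬wraps-pos-neg-mid : ∀ o₁ x₂ q o₂ → x₂ + o₂ ≡ M → o₂ < q → o₁ + q < M → ¬ Wraps M (o₁ + x₂ + q)
  ¬wraps-pos-neg-mid o₁ x₂ q o₂ x₂+o₂≡M o₂<q o₁+q<M wraps with wraps-shift total wraps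
    where
    total : o₁ + x₂ + q + o₂ ≡ M + (o₁ + q)
    total = begin
      o₁ + x₂ + q + o₂     ≡⟨ solve (o₁ ∷ x₂ ∷ q ∷ o₂ ∷ []) ⟩
      (x₂ + o₂) + (o₁ + q) ≡⟨ cong (_+ (o₁ + q)) x₂+o₂≡M ⟩
      M + (o₁ + q)         ∎
  ... | inj₁ e = <⇒≱ o₂<q (subst (q ≤_) (sym e) (m≤n+m q o₁))
  ... | inj₂ e = <⇒≱ o₁+q<M (subst (M ≤_) e (m≤m+n M o₂))

  ¬wraps-neg-neg-neg : ∀ x₁ x₂ x₃ o₁ o₂ o₃ → x₁ + o₁ ≡ M → x₂ + o₂ ≡ M → x₃ + o₃ ≡ M → o₁ + o₂ + o₃ < M →
                       ¬ Wraps M (x₁ + x₂ + x₃)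
  ¬wraps-neg-neg-neg x₁ x₂ x₃ o₁ o₂ o₃ x₁+o₁≡M x₂+o₂≡M x₃+o₃≡M O<M wraps with wraps-shift total wraps
    where
    total : x₁ + x₂ + x₃ + (o₁ + o₂ + o₃) ≡ M + (M + M)
    total = begin
      x₁ + x₂ + x₃ + (o₁ + o₂ + o₃)        ≡⟨ solve (x₁ ∷ x₂ ∷ x₃ ∷ o₁ ∷ o₂ ∷ o₃ ∷ []) ⟩
      (x₁ + o₁) + ((x₂ + o₂) + (x₃ + o₃)) ≡⟨ cong₂ _+_ x₁+o₁≡M (cong₂ _+_ x₂+o₂≡M x₃+o₃≡M) ⟩
      M + (M + M)                         ∎
  ... | inj₁ e = <⇒≱ O<M (subst (M ≤_) (sym e) (m≤m+n M M))
  ... | inj₂ e = <-irrefl (+-cancelˡ-≡ M _ _ e) O<M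

  ¬wraps-neg-neg-mid : ∀ x₁ x₂ q o₁ o₂ → x₁ + o₁ ≡ M → x₂ + o₂ ≡ M → o₁ + o₂ < q → ¬ Wraps M (x₁ + x₂ + q)
  ¬wraps-neg-neg-mid x₁ x₂ q o₁ o₂ x₁+o₁≡M x₂+o₂≡M o₁+o₂<q wraps with wraps-shift total wraps
    where
    total : x₁ + x₂ + q + (o₁ + o₂) ≡ M + (M + q)
    total = begin
      x₁ + x₂ + q + (o₁ + o₂)      ≡⟨ solve (x₁ ∷ x₂ ∷ q ∷ o₁ ∷ o₂ ∷ []) ⟩
      (x₁ + o₁) + ((x₂ + o₂) + q) ≡⟨ cong₂ (λ p p′ → p + (p′ + q)) x₁+o₁≡M x₂+o₂≡M ⟩
      M + (M + q)                 ∎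
  ... | inj₁ e = <⇒≱ o₁+o₂<q (subst (q ≤_) (sym e) (m≤n+m q M))
  ... | inj₂ e = <-irrefl (+-cancelˡ-≡ M _ _ e) o₁+o₂<q

  ¬wraps-neg-mid-mid : ∀ x q₁ q₂ o → x + o ≡ M → o < q₁ → M + o ≢ q₁ + q₂ → ¬ Wraps M (x + q₁ + q₂)
  ¬wraps-neg-mid-mid x q₁ q₂ o x+o≡M o<q₁ M+o≢q₁+q₂ wraps with wraps-shift total wraps
    where
    total : x + q₁ + q₂ + o ≡ M + (q₁ + q₂)
    total = begin
      x + q₁ + q₂ + o    ≡⟨ solve (x ∷ q₁ ∷ q₂ ∷ o ∷ []) ⟩
      (x + o) + (q₁ + q₂) ≡⟨ cong (_+ (q₁ + q₂)) x+o≡M ⟩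
      M + (q₁ + q₂)      ∎
  ... | inj₁ e = <⇒≱ o<q₁ (subst (q₁ ≤_) (sym e) (m≤m+n q₁ q₂))
  ... | inj₂ e = M+o≢q₁+q₂ e

module _ {a s t : ℕ} where
  open ≡-Reasoning

  pos+mid+mid≢M : ∀ {o j₁ j₂} → 0 < o → o < s → o + (a + s * j₁) + (a + s * j₂) ≢ a + a + s * t
  pos+mid+mid≢M {o} {j₁} {j₂} 0<o o<s e = c+s*x≢s*y 0<o o<s (+-cancelˡ-≡ (a + a) _ _ (begin
    a + a + (o + s * (j₁ + j₂))     ≡⟨ solve (a ∷ s ∷ o ∷ j₁ ∷ j₂ ∷ []) ⟩
    o + (a + s * j₁) + (a + s * j₂) ≡⟨ e ⟩
    a + a + s * t                   ∎))

  M+neg≢mid+mid : ∀ {o j₁ j₂} → 0 < o → o < s → a + a + s * t + o ≢ (a + s * j₁) + (a + s * j₂)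
  M+neg≢mid+mid {o} {j₁} {j₂} 0<o o<s e = c+s*x≢s*y 0<o o<s (+-cancelˡ-≡ (a + a) _ _ (begin
    a + a + (o + s * t)           ≡⟨ solve (a ∷ s ∷ t ∷ o ∷ []) ⟩
    a + a + s * t + o             ≡⟨ e ⟩
    (a + s * j₁) + (a + s * j₂)   ≡⟨ solve (a ∷ s ∷ j₁ ∷ j₂ ∷ []) ⟩
    a + a + s * (j₁ + j₂)         ∎))

  mid+mid+mid≢M : ∀ {j₁ j₂ j₃} → 0 < a → a < s → (a + s * j₁) + (a + s * j₂) + (a + s * j₃) ≢ a + a + s * t
  mid+mid+mid≢M {j₁} {j₂} {j₃} 0<a a<s e = c+s*x≢s*y 0<a a<s (+-cancelˡ-≡ (a + a) _ _ (begin
    a + a + (a + s * (j₁ + j₂ + j₃))             ≡⟨ solve (a ∷ s ∷ j₁ ∷ j₂ ∷ j₃ ∷ []) ⟩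
    (a + s * j₁) + (a + s * j₂) + (a + s * j₃) ≡⟨ e ⟩
    a + a + s * t                               ∎))

  mid+mid+mid≢2M : ∀ {j₁ j₂ j₃} → 0 < a → a < s →
                   (a + s * j₁) + (a + s * j₂) + (a + s * j₃) ≢ (a + a + s * t) + (a + a + s * t)
  mid+mid+mid≢2M {j₁} {j₂} {j₃} 0<a a<s e = c+s*x≢s*y 0<a a<s (sym (+-cancelˡ-≡ (a + a + a) _ _ (begin
    a + a + a + s * (j₁ + j₂ + j₃)             ≡⟨ solve (a ∷ s ∷ j₁ ∷ j₂ ∷ j₃ ∷ []) ⟩
    (a + s * j₁) + (a + s * j₂) + (a + s * j₃) ≡⟨ e ⟩
    (a + a + s * t) + (a + a + s * t)          ≡⟨ solve (a ∷ s ∷ t ∷ []) ⟩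
    a + a + a + (a + s * (t + t))              ∎)))

parity : ∀ n → ∃[ k ] (n ≡ 2 * k ⊎ n ≡ suc (2 * k))
parity zero = 0 , inj₁ refl
parity (suc n) with parity n
... | k , inj₁ refl = k , inj₂ refl
... | k , inj₂ refl = suc k , inj₁ (cong suc (sym (+-suc k (k + 0))))

module _ {M : ℕ} where
  open ≡-Reasoning

  reflect-sum : ∀ {x x′ y y′ z z′} → x + x′ ≡ M → y + y′ ≡ M → x′ + y′ ≡ z′ → z′ + z ≡ M → x + y ≡ z + M
  reflect-sum {x} {x′} {y} {y′} {z} {z′} xx′ yy′ x′y′ z′z = +-cancelˡ-≡ z′ _ _ (begin
    z′ + (x + y)            ≡⟨ cong (_+ (x + y)) x′y′ ⟨
    x′ + y′ + (x + y)       ≡⟨ solve (x′ ∷ y′ ∷ x ∷ y ∷ []) ⟩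
    (x + x′) + (y + y′)     ≡⟨ cong₂ _+_ xx′ yy′ ⟩
    M + M                   ≡⟨ cong (_+ M) z′z ⟨
    z′ + z + M              ≡⟨ +-assoc z′ z M ⟩
    z′ + (z + M)            ∎)

  next-spine-sum : ∀ {a s q e o y z} → y + o ≡ M → e + o ≡ s → z ≡ a + (e + q * s) → a + s * suc q + y ≡ z + M
  next-spine-sum {a} {s} {q} {e} {o} {y} {z} yo eo refl = +-cancelʳ-≡ o _ _ (begin
    a + s * suc q + y + o    ≡⟨ +-assoc (a + s * suc q) y o ⟩
    a + s * suc q + (y + o)  ≡⟨ cong (a + s * suc q +_) yo ⟩
    a + s * suc q + M        ≡⟨ solve (a ∷ s ∷ q ∷ M ∷ []) ⟩
    a + q * s + s + M        ≡⟨ cong (λ s′ → a + q * s + s′ + M) eo ⟨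
    a + q * s + (e + o) + M  ≡⟨ solve (a ∷ q ∷ s ∷ e ∷ o ∷ M ∷ []) ⟩
    a + (e + q * s) + M + o  ∎)

mid+mid≡ : ∀ a s j d → a + s * j + (a + s * d) ≡ a + a + s * (j + d)
mid+mid≡ = solve-∀

mid+pos≡ : ∀ a s q e → a + s * q + e ≡ a + (e + q * s)
mid+pos≡ = solve-∀

even+odd≡ : ∀ p δ → 2 * suc p + suc (2 * δ) ≡ suc (suc (suc (2 * (p + δ))))
even+odd≡ = solve-∀

r²+r<[2r+3][r+1] : ∀ r → r * r + r < suc (suc (suc (2 * r))) * suc r
r²+r<[2r+3][r+1] r = subst (r * r + r <_) (sym (expand r)) (m<m+n (r * r + r) (s≤s z≤n))
  where
  expand : ∀ r → suc (suc (suc (2 * r))) * suc r ≡ r * r + r + suc (r * r + 4 * r + 2)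
  expand = solve-∀

q[6r+9]≤r²+r : ∀ q r → 9 * q ≤ r → q * (6 * r + 9) ≤ r * r + r
q[6r+9]≤r²+r q r 9q≤r = begin
  q * (6 * r + 9)      ≡⟨ solve (q ∷ r ∷ []) ⟩
  6 * q * r + 9 * q    ≤⟨ +-mono-≤ (*-monoˡ-≤ r (≤-trans (*-monoˡ-≤ q 6≤9) 9q≤r)) 9q≤r ⟩
  r * r + r            ∎
  where
  open ≤-Reasoning
  6≤9 : 6 ≤ 9
  6≤9 = s≤s (s≤s (s≤s (s≤s (s≤s (s≤s z≤n)))))

[3r+4]+[3r+4]+1≡6r+9 : ∀ r → (suc r + (suc r + suc (suc r))) + (suc r + (suc r + suc (suc r))) + 1 ≡ 6 * r + 9
[3r+4]+[3r+4]+1≡6r+9 = solve-∀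

module SumFreeSet (r : ℕ) where

  odd : ℕ → ℕ
  odd k = suc (2 * k)

  a s t m : ℕ
  a = odd r
  s = suc (suc a)
  t = suc r
  m = a + a + s * t

  -- the elements of S, represented by naturals below m
  data Form : ℕ → Set where
    pos : ∀ {k} → k ≤ r → Form (odd k)
    neg : ∀ {k x} → k ≤ r → x + odd k ≡ m → Form x
    mid : ∀ {j} → 0 < j → j < t → Form (a + s * j)

  odd-≤ : ∀ {k} → k ≤ r → odd k ≤ a
  odd-≤ k≤r = s≤s (*-monoʳ-≤ 2 k≤r)

  a<s : a < s
  a<s = <-trans (n<1+n a) (n<1+n (suc a))

  odd<s : ∀ {k} → k ≤ r → odd k < s
  odd<s k≤r = ≤-<-trans (odd-≤ k≤r) a<s

  mid-≥ : ∀ {j} → 0 < j → a + s ≤ a + s * j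
  mid-≥ {j} 0<j = +-monoʳ-≤ a (subst (_≤ s * j) (*-identityʳ s) (*-monoʳ-≤ s 0<j))

  mid-≤ : ∀ {j} → j < t → a + s * j ≤ a + s * r
  mid-≤ j<t = +-monoʳ-≤ a (*-monoʳ-≤ s (≤-pred j<t))

  odd<mid : ∀ {k j} → k ≤ r → 0 < j → odd k < a + s * j
  odd<mid k≤r 0<j = <-≤-trans (≤-<-trans (odd-≤ k≤r) (m<m+n a 0<s)) (mid-≥ 0<j)
    where 0<s = s≤s z≤n

  below-m : ∀ {X} → X ≤ a + a + (a + s * r) → X < m
  below-m X≤ = ≤-<-trans X≤ (subst (a + a + (a + s * r) <_) (cong (a + a +_) (sym (*-suc s r)))
                                  (+-monoʳ-< (a + a) (+-monoˡ-< (s * r) a<s)))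

  mid<m : ∀ {j} → j < t → a + s * j < m
  mid<m j<t = below-m (≤-trans (mid-≤ j<t) (m≤n+m _ (a + a)))

  private
    pos+pos<m : ∀ {i j} → i ≤ r → j ≤ r → odd i + odd j < m
    pos+pos<m i≤r j≤r = below-m (≤-trans (+-mono-≤ (odd-≤ i≤r) (odd-≤ j≤r)) (m≤m+n (a + a) _))

    pos+mid<m : ∀ {i j} → i ≤ r → j < t → odd i + (a + s * j) < m
    pos+mid<m i≤r j<t = below-m (≤-trans (+-mono-≤ (odd-≤ i≤r) (mid-≤ j<t)) (+-monoˡ-≤ (a + s * r) (m≤n+m a a)))

    pos+pos+≤<m : ∀ {i j x} → i ≤ r → j ≤ r → x ≤ a + s * r → odd i + odd j + x < m
    pos+pos+≤<m i≤r j≤r x≤ = below-m (+-mono-≤ (+-mono-≤ (odd-≤ i≤r) (odd-≤ j≤r)) x≤)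

    pos+pos<mid : ∀ {i k j} → i ≤ r → k ≤ r → 0 < j → odd i + odd k < a + s * j
    pos+pos<mid i≤r k≤r 0<j =
      <-≤-trans (≤-<-trans (+-mono-≤ (odd-≤ i≤r) (odd-≤ k≤r)) (+-monoʳ-< a a<s)) (mid-≥ 0<j)

  rank : ∀ {x} → Form x → ℕ
  rank (pos _)   = 0
  rank (neg _ _) = 1
  rank (mid _ _) = 2

  sum-free-sorted : ∀ {x y z} (fx : Form x) (fy : Form y) (fz : Form z) →
                    rank fx ≤ rank fy → rank fy ≤ rank fz → ¬ Wraps m (x + y + z)
  sum-free-sorted (pos i) (pos j) (pos k) _ _ =
    ¬wraps-< (pos+pos+≤<m i j (≤-trans (odd-≤ k) (m≤m+n a _)))
  sum-free-sorted (pos {i′} i) (pos {j′} j) (neg {k′} {x} k e) _ _ =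
    ¬wraps-pos-pos-neg (odd i′) (odd j′) x (odd k′) e (odd+odd≢odd i′ j′ k′) (pos+pos<m i j)
  sum-free-sorted (pos i) (pos j) (mid _ j<t) _ _ = ¬wraps-< (pos+pos+≤<m i j (mid-≤ j<t))
  sum-free-sorted (pos {i′} i) (neg {j′} {y} j e) (neg {k′} {z} k e′) _ _ =
    ¬wraps-pos-neg-neg (odd i′) y z (odd j′) (odd k′) e e′ (odd+odd≢odd j′ k′ i′) (pos+pos<m j k)
  sum-free-sorted (pos {i′} i) (neg {j′} {y} j e) (mid {l} 0<l l<t) _ _ =
    ¬wraps-pos-neg-mid (odd i′) y (a + s * l) (odd j′) e (odd<mid j 0<l) (pos+mid<m i l<t)
  sum-free-sorted (pos i) (mid {j₁} _ j₁<t) (mid {j₂} _ j₂<t) _ _ (inj₁ e) =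
    pos+mid+mid≢M {a} {s} {t} {j₁ = j₁} {j₂} (s≤s z≤n) (odd<s i) e
  sum-free-sorted (pos i) (mid _ j₁<t) (mid _ j₂<t) _ _ (inj₂ e) =
    <-irrefl e (+-mono-< (pos+mid<m i j₁<t) (mid<m j₂<t))
  sum-free-sorted (neg {i′} {x} i e) (neg {j′} {y} j e′) (neg {k′} {z} k e″) _ _ =
    ¬wraps-neg-neg-neg x y z (odd i′) (odd j′) (odd k′) e e′ e″ (pos+pos+≤<m i j (≤-trans (odd-≤ k) (m≤m+n a _)))
  sum-free-sorted (neg {i′} {x} i e) (neg {j′} {y} j e′) (mid {l} 0<l _) _ _ =
    ¬wraps-neg-neg-mid x y (a + s * l) (odd i′) (odd j′) e e′ (pos+pos<mid i j 0<l)
  sum-free-sorted (neg {i′} {x} i e) (mid {j₁} 0<j₁ _) (mid {j₂} _ _) _ _ =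
    ¬wraps-neg-mid-mid x (a + s * j₁) (a + s * j₂) (odd i′) e (odd<mid i 0<j₁)
      (M+neg≢mid+mid {a} {s} {t} {j₁ = j₁} {j₂} (s≤s z≤n) (odd<s i))
  sum-free-sorted (mid {j₁} _ _) (mid {j₂} _ _) (mid {j₃} _ _) _ _ (inj₁ e) =
    mid+mid+mid≢M {a} {s} {t} {j₁} {j₂} {j₃} (s≤s z≤n) a<s e
  sum-free-sorted (mid {j₁} _ _) (mid {j₂} _ _) (mid {j₃} _ _) _ _ (inj₂ e) =
    mid+mid+mid≢2M {a} {s} {t} {j₁} {j₂} {j₃} (s≤s z≤n) a<s e
  sum-free-sorted (neg _ _) (pos _)   _ () _
  sum-free-sorted (mid _ _) (pos _)   _ () _
  sum-free-sorted (mid _ _) (neg _ _) _ (s≤s ()) _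
  sum-free-sorted _ (neg _ _) (pos _)   _ ()
  sum-free-sorted _ (mid _ _) (pos _)   _ ()
  sum-free-sorted _ (mid _ _) (neg _ _) _ (s≤s ())

  private
    reorder : ∀ {X Y} → X ≡ Y → ¬ Wraps m Y → ¬ Wraps m X
    reorder refl ¬wraps = ¬wraps

  sum-free : ∀ {x y z} → Form x → Form y → Form z → ¬ Wraps m (x + y + z)
  sum-free {x} {y} {z} fx fy fz
    with ≤-total (rank fx) (rank fy) | ≤-total (rank fy) (rank fz) | ≤-total (rank fx) (rank fz)
  ... | inj₁ xy | inj₁ yz | _       = sum-free-sorted fx fy fz xy yz
  ... | inj₁ xy | inj₂ zy | inj₁ xz = reorder (xy∙z≈xz∙y x y z) (sum-free-sorted fx fz fy xz zy)
  ... | inj₁ xy | inj₂ zy | inj₂ zx = reorder (xy∙z≈zx∙y x y z) (sum-free-sorted fz fx fy zx xy)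
  ... | inj₂ yx | inj₁ yz | inj₁ xz = reorder (xy∙z≈yx∙z x y z) (sum-free-sorted fy fx fz yx xz)
  ... | inj₂ yx | inj₁ yz | inj₂ zx = reorder (xy∙z≈yz∙x x y z) (sum-free-sorted fy fz fx yz zx)
  ... | inj₂ yx | inj₂ zy | _       = reorder (xy∙z≈zy∙x x y z) (sum-free-sorted fz fy fx zy yx)

  odd<m : ∀ {k} → k ≤ r → odd k < m
  odd<m k≤r = below-m (≤-trans (odd-≤ k≤r) (≤-trans (m≤m+n a a) (m≤m+n (a + a) _)))

  form-positive : ∀ {x} → Form x → 0 < x
  form-positive (pos _) = s≤s z≤n
  form-positive (neg k≤r e) = n≢0⇒n>0 λ { refl → <-irrefl e (odd<m k≤r) }
  form-positive (mid _ _) = s≤s z≤n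

  form<m : ∀ {x} → Form x → x < m
  form<m (pos k≤r) = odd<m k≤r
  form<m (neg {x = x} _ e) = subst (x <_) e (m<m+n x (s≤s z≤n))
  form<m (mid _ j<t) = mid<m j<t

  -- the endpoints j = 0 and j = t of the spine are a and m − a
  spine : ∀ {j} → j ≤ t → Form (a + s * j)
  spine {zero} _ = subst Form (sym (trans (cong (a +_) (*-zeroʳ s)) (+-identityʳ a))) (pos ≤-refl)
  spine {suc j} j≤t with m≤n⇒m<n∨m≡n j≤t
  ... | inj₁ j<t = mid (s≤s z≤n) j<t
  ... | inj₂ refl = neg ≤-refl (trans (+-comm _ a) (sym (+-assoc a a _)))

  form-neg : ∀ {x y} → x + y ≡ m → Form x → Form y
  form-neg {y = y} e (pos {k} k≤r) = neg k≤r (trans (+-comm y (odd k)) e)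
  form-neg {x} e (neg k≤r e′) = subst Form (+-cancelˡ-≡ x _ _ (trans e′ (sym e))) (pos k≤r)
  form-neg {y = y} e (mid {j} _ j<t) = subst Form (sym y≡) (spine (m∸n≤m t j))
    where
    y≡ : y ≡ a + s * (t ∸ j)
    y≡ = +-cancelˡ-≡ (a + s * j) _ _ (trans e (sym (trans (mid+mid≡ a s j _)
           (cong (λ t′ → a + a + s * t′) (m+[n∸m]≡n (<⇒≤ j<t))))))

  pos? : ∀ x → Dec (∃[ k ] k < suc r × x ≡ odd k)
  pos? x = anyUpTo? (λ k → x ≟ℕ odd k) (suc r)

  neg? : ∀ x → Dec (∃[ k ] k < suc r × x ≡ m ∸ odd k)
  neg? x = anyUpTo? (λ k → x ≟ℕ m ∸ odd k) (suc r)

  mid? : ∀ x → Dec (∃[ j ] j < suc t × x ≡ a + s * j)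
  mid? x = anyUpTo? (λ j → x ≟ℕ a + s * j) (suc t)

  S : ℕ → Bool
  S x = ⌊ pos? x ⌋ ∨ (⌊ neg? x ⌋ ∨ ⌊ mid? x ⌋)

  S⇒form : ∀ {x} → S x ≡ true → Form x
  S⇒form {x} h with ∨-true⁻¹ ⌊ pos? x ⌋ h
  ... | inj₁ h-pos with ⌊⌋-true⁻¹ (pos? x) h-pos
  ...   | k , k<1+r , refl = pos (≤-pred k<1+r)
  S⇒form {x} h | inj₂ h′ with ∨-true⁻¹ ⌊ neg? x ⌋ h′
  ... | inj₁ h-neg with ⌊⌋-true⁻¹ (neg? x) h-neg
  ...   | k , k<1+r , refl = neg (≤-pred k<1+r) (m∸n+n≡m (<⇒≤ (odd<m (≤-pred k<1+r))))
  S⇒form {x} h | inj₂ h′ | inj₂ h-mid with ⌊⌋-true⁻¹ (mid? x) h-mid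
  ...   | j , j<1+t , refl = spine (≤-pred j<1+t)

  form⇒S : ∀ {x} → Form x → S x ≡ true
  form⇒S (pos {k} k≤r) = ∨-trueˡ _ (⌊⌋-true (pos? (odd k)) (k , s≤s k≤r , refl))
  form⇒S (neg {k} {x} k≤r e) = ∨-trueʳ ⌊ pos? x ⌋ (∨-trueˡ _ (⌊⌋-true (neg? x) (k , s≤s k≤r , x≡)))
    where
    x≡ : x ≡ m ∸ odd k
    x≡ = trans (sym (m+n∸n≡m x (odd k))) (cong (_∸ odd k) e)
  form⇒S (mid {j} _ j<t) =
    ∨-trueʳ ⌊ pos? (a + s * j) ⌋ (∨-trueʳ ⌊ neg? (a + s * j) ⌋ (⌊⌋-true (mid? _) (j , m<n⇒m<1+n j<t , refl)))

  ∣S∣ : ℕ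
  ∣S∣ = countTrue {m} (S ∘ toℕ)

  ∣S∣≤ : ∣S∣ ≤ suc r + (suc r + suc t)
  ∣S∣≤ = ≤-trans (countTrue-≤-∨ {m} {S ∘ toℕ} {pos-at} {neg-or-mid-at} (λ w → ∨-true⁻¹ (pos-at w)))
    (+-mono-≤ (countTrue-image {m} odd (suc r))
              (≤-trans (countTrue-≤-∨ {m} {neg-or-mid-at} {neg-at} {mid-at} (λ w → ∨-true⁻¹ (neg-at w)))
                       (+-mono-≤ (countTrue-image {m} (λ k → m ∸ odd k) (suc r))
                                 (countTrue-image {m} (λ j → a + s * j) (suc t)))))
    where
    pos-at neg-at mid-at neg-or-mid-at : Fin m → Bool
    pos-at w = ⌊ pos? (toℕ w) ⌋
    neg-at w = ⌊ neg? (toℕ w) ⌋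
    mid-at w = ⌊ mid? (toℕ w) ⌋
    neg-or-mid-at w = neg-at w ∨ mid-at w

  complete-low : ∀ {z} → 0 < z → z ≤ a → ¬ Form z → ∃₂ λ x y → Form x × Form y × x + y ≡ z
  complete-low {z} 0<z z≤a ¬form with parity z
  ... | k , inj₂ refl = contradiction (pos {k} (*-cancelˡ-≤ 2 (≤-pred z≤a))) ¬form
  ... | zero , inj₁ refl = contradiction 0<z λ ()
  ... | suc p , inj₁ refl = odd 0 , odd p , pos z≤n , pos p≤r , sym (*-suc 2 p)
    where
    p≤r : p ≤ r
    p≤r = *-cancelˡ-≤ 2 (≤-trans (n≤1+n (2 * p)) (≤-pred (subst (_≤ a) (*-suc 2 p) z≤a)))

  -- write z = a + (e + q s) with e < s; for odd e, z = (a + s q) + e,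
  -- and for even e ≠ 0, z + m = (a + s (q + 1)) + (m − (s − e))
  complete-mid : ∀ {z} → a < z → z + a < m → ¬ Form z →
                 ∃₂ λ x y → Form x × Form y × (x + y ≡ z ⊎ x + y ≡ z + m)
  complete-mid {z} a<z z+a<m ¬form = by-parity (parity e)
    where
    d e q : ℕ
    d = z ∸ a
    e = d % s
    q = d / s
    z≡ : z ≡ a + (e + q * s)
    z≡ = trans (sym (m+[n∸m]≡n (<⇒≤ a<z))) (cong (a +_) (m≡m%n+[m/n]*n d s))
    e<s : e < s
    e<s = m%n<n d s
    q<t : q < t
    q<t = m<n*o⇒m/o<n (subst (d <_) (*-comm s t) (+-cancelˡ-< (a + a) d (s * t)
            (subst (_< m) (trans (cong (_+ a) (sym (m+[n∸m]≡n (<⇒≤ a<z)))) (xy∙z≈xz∙y a d a)) z+a<m)))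
    s≡ : s ≡ suc (2 * suc r)
    s≡ = cong suc (sym (*-suc 2 r))
    by-parity : ∃[ k ] (e ≡ 2 * k ⊎ e ≡ suc (2 * k)) → ∃₂ λ x y → Form x × Form y × (x + y ≡ z ⊎ x + y ≡ z + m)
    by-parity (k , inj₂ e≡odd) = a + s * q , odd k , spine (<⇒≤ q<t) , pos k≤r , inj₁ (begin
      a + s * q + odd k    ≡⟨ mid+pos≡ a s q (odd k) ⟩
      a + (odd k + q * s)  ≡⟨ cong (λ e′ → a + (e′ + q * s)) e≡odd ⟨
      a + (e + q * s)      ≡⟨ z≡ ⟨
      z                    ∎)
      where
      open ≡-Reasoning
      k≤r : k ≤ r
      k≤r = ≤-pred (*-cancelˡ-< 2 k (suc r) (≤-pred (subst₂ _<_ e≡odd s≡ e<s)))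
    by-parity (zero , inj₁ e≡0) = contradiction (subst Form (begin
      a + s * q            ≡⟨ +-identityʳ _ ⟨
      a + s * q + 0        ≡⟨ mid+pos≡ a s q 0 ⟩
      a + (0 + q * s)      ≡⟨ cong (λ e′ → a + (e′ + q * s)) e≡0 ⟨
      a + (e + q * s)      ≡⟨ z≡ ⟨
      z                    ∎) (spine (<⇒≤ q<t))) ¬form
      where open ≡-Reasoning
    by-parity (suc p , inj₁ e≡even) = a + s * suc q , m ∸ odd δ , spine q<t , neg δ≤r y+odd≡m ,
      inj₂ (next-spine-sum {m} {a} {s} {q} {e} {odd δ} {m ∸ odd δ} {z} y+odd≡m e+odd≡s z≡)
      where
      p≤r : p ≤ r
      p≤r = ≤-pred (*-cancelˡ-≤ 2 (≤-pred (subst₂ _<_ e≡even s≡ e<s)))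
      δ = r ∸ p
      δ≤r : δ ≤ r
      δ≤r = m∸n≤m r p
      y+odd≡m : m ∸ odd δ + odd δ ≡ m
      y+odd≡m = m∸n+n≡m (<⇒≤ (odd<m δ≤r))
      e+odd≡s : e + odd δ ≡ s
      e+odd≡s = begin
        e + odd δ                              ≡⟨ cong (_+ odd δ) e≡even ⟩
        2 * suc p + suc (2 * δ)                ≡⟨ even+odd≡ p δ ⟩
        suc (suc (suc (2 * (p + δ))))          ≡⟨ cong (λ r′ → suc (suc (suc (2 * r′)))) (m+[n∸m]≡n p≤r) ⟩
        s                                      ∎
        where open ≡-Reasoning

  complete : ∀ {z} → 0 < z → z < m → ¬ Form z → ∃₂ λ x y → Form x × Form y × (x + y ≡ z ⊎ x + y ≡ z + m)
  complete {z} 0<z z<m ¬form with z ≤? a | m ≤? z + a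
  ... | yes z≤a | _ = let (x , y , fx , fy , x+y≡z) = complete-low 0<z z≤a ¬form in x , y , fx , fy , inj₁ x+y≡z
  ... | no z≰a | no m≰z+a = complete-mid (≰⇒> z≰a) (≰⇒> m≰z+a) ¬form
  ... | no _ | yes m≤z+a =
    reflect (complete-low (m<n⇒0<n∸m z<m) (subst (m ∸ z ≤_) (m+n∸m≡n z a) (∸-monoˡ-≤ z m≤z+a))
                          (¬form ∘ form-neg z′+z≡m))
    where
    z′+z≡m : m ∸ z + z ≡ m
    z′+z≡m = m∸n+n≡m (<⇒≤ z<m)
    -- z ↦ m − z maps z into the range of complete-low, and x ↦ m − x preserves Form
    reflect : (∃₂ λ x′ y′ → Form x′ × Form y′ × x′ + y′ ≡ m ∸ z) →
              ∃₂ λ x y → Form x × Form y × (x + y ≡ z ⊎ x + y ≡ z + m)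
    reflect (x′ , y′ , fx′ , fy′ , x′+y′≡z′) =
      m ∸ x′ , m ∸ y′ , form-neg (m+[n∸m]≡n x′≤m) fx′ , form-neg (m+[n∸m]≡n y′≤m) fy′ ,
      inj₂ (reflect-sum {m} {m ∸ x′} {x′} {m ∸ y′} {y′} {z} {m ∸ z} (m∸n+n≡m x′≤m) (m∸n+n≡m y′≤m) x′+y′≡z′ z′+z≡m)
      where
      x′≤m = <⇒≤ (form<m fx′)
      y′≤m = <⇒≤ (form<m fy′)

  S-<m : ∀ {x} → S x ≡ true → x < m
  S-<m {x} = form<m ∘ S⇒form {x}

  0∉S : S 0 ≡ false
  0∉S = Boolₚ.¬-not λ S0 → <-irrefl refl (form-positive (S⇒form S0))

  S-neg : ∀ {x y} → x + y ≡ m → S x ≡ true → S y ≡ true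
  S-neg {x} x+y≡m = form⇒S ∘ form-neg x+y≡m ∘ S⇒form {x}

  S-sum-free : ∀ {x y z} → S x ≡ true → S y ≡ true → S z ≡ true → ¬ (x + y + z ≡ 0 mod m)
  S-sum-free {x} {y} {z} Sx Sy Sz x+y+z≡0 = sum-free fx fy fz (mod0⇒wraps x+y+z≡0
    (<-≤-trans (form-positive fx) (≤-trans (m≤m+n x y) (m≤m+n (x + y) z))) (+<3* (form<m fx) (form<m fy) (form<m fz)))
    where
    fx = S⇒form {x} Sx
    fy = S⇒form {y} Sy
    fz = S⇒form {z} Sz

  S-complete : ∀ {z} → 0 < z → z < m → S z ≡ false → ∃₂ λ x y → S x ≡ true × S y ≡ true × (x + y ≡ z mod m)
  S-complete {z} 0<z z<m Sz with complete 0<z z<m (λ fz → contradiction (trans (sym (form⇒S {z} fz)) Sz) λ ())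
  ... | x , y , fx , fy , inj₁ x+y≡z = x , y , form⇒S fx , form⇒S fy , ≡⇒≡-mod x+y≡z
  ... | x , y , fx , fy , inj₂ x+y≡z+m = x , y , form⇒S fx , form⇒S fy , ≡+m⇒≡-mod x+y≡z+m

  open Circulant m S (λ {x} → S-<m {x}) 0∉S (λ {x} {y} → S-neg {x} {y})
    (λ {x} {y} {z} → S-sum-free {x} {y} {z}) (λ {z} → S-complete {z}) public

  r²+r<m : r * r + r < m
  r²+r<m = <-≤-trans (r²+r<[2r+3][r+1] r) (m≤n+m (s * t) (a + a))

  r≤m*2 : r ≤ m * 2
  r≤m*2 = ≤-trans (m≤n+m r (r * r)) (≤-trans (<⇒≤ r²+r<m) (m≤m*n m 2))

  q*blowK2-degree<m*2 : ∀ {q} → 9 * q ≤ r → q * (∣S∣ + ∣S∣ + 1) < m * 2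
  q*blowK2-degree<m*2 {q} 9q≤r = begin-strict
    q * (∣S∣ + ∣S∣ + 1)                                            ≤⟨ *-monoʳ-≤ q (+-mono-≤ (+-mono-≤ ∣S∣≤ ∣S∣≤) ≤-refl) ⟩
    q * (suc r + (suc r + suc t) + (suc r + (suc r + suc t)) + 1) ≡⟨ cong (q *_) ([3r+4]+[3r+4]+1≡6r+9 r) ⟩
    q * (6 * r + 9)                                                ≤⟨ q[6r+9]≤r²+r q r 9q≤r ⟩
    r * r + r                                                      <⟨ r²+r<m ⟩
    m                                                              ≤⟨ m≤m*n m 2 ⟩
    m * 2                                                          ∎
    where open ≤-Reasoning

-- r = 9q + N gives q (2|S| + 1) ≤ q (6r + 9) ≤ r² + r < m · 2, the number of vertices of the blow-up
sparse-saturated-blow-ups : ∀ {k} (F : Adj k) → adj F6 ⊑ F → F ⊑ adj K3'2 → ∀ p q → 0 < p → ∀ N →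
  ∃[ n ] (N ≤ n × Σ (Graph n) λ H → Regular (adj H) × Saturated F (adj H) × q * edges (adj H) < p * (n * n))
sparse-saturated-blow-ups F F6⊑F F⊑K3'2 p q 0<p N =
  m * 2 , ≤-trans (m≤n+m N (9 * q)) r≤m*2 ,
  blowK2-graph circulant , blowK2-regular circulant C-regular ,
  blowK2-saturated circulant C-saturated F F6⊑F F⊑K3'2 ,
  regular⇒q*edges<p*n² (blowK2 C) {p = p} {q = q} (proj₂ (blowK2-regular circulant C-regular)) 0<p
    (q*blowK2-degree<m*2 {q} (m≤m+n (9 * q) N))
  where open SumFreeSet (9 * q + N)

theorem3p2 : ((n : ℕ) (G : Graph n) → Regular (adj G) → Saturated (adj K3) (adj G) →
      (k : ℕ) (F : Graph k) → adj F6 ⊑ adj F → adj F ⊑ adj K3'2 →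
      Regular (blowK2 (adj G)) × Saturated (adj F) (blowK2 (adj G)))
    ×
    ((k : ℕ) (F : Graph k) → adj F6 ⊑ adj F → adj F ⊑ adj K3'2 →
      (p q : ℕ) → 0 < p → 0 < q → (N : ℕ) →
      ∃[ n ] (N ≤ n × Σ (Graph n) λ H →
        Regular (adj H) × Saturated (adj F) (adj H) × q * edges (adj H) < p * (n * n)))
theorem3p2 =
  (λ n G regular saturated k F F6⊑F F⊑K3'2 →
    blowK2-regular G regular , blowK2-saturated G saturated (adj F) F6⊑F F⊑K3'2) ,
  (λ k F F6⊑F F⊑K3'2 p q 0<p _ N → sparse-saturated-blow-ups (adj F) F6⊑F F⊑K3'2 p q 0<p N)
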